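{- Let $k\ge1$. In any self-avoiding polygon, to the left of a $k$-section there are at least $3k-2$ vertical bonds, of which at least $2k-1$ obstruct section lines; likewise to the right of a $k$-section. Hence no polygon with fewer than $6k-4$ vertical bonds contains a $k$-section. Further, for every $k\ge1$ there exists a polygon with exactly $6k-4$ vertical bonds containing exactly one $k$-section.
   Context: Work on the square lattice; a self-avoiding polygon is a finite connected set of lattice bonds forming the embedding of a simple closed loop, considered up to translation. Section lines: through the centre of each row of lattice cells, draw a horizontal ray from $x=-\infty$ moving right and one from $x=+\infty$ moving left; each ray stops when it first meets a vertical bond of the polygon, and that vertical bond is said to obstruct (block) the section line. Cut the plane along each section line up to its terminating vertical bond, and from that bond cut vertically up and down until another section line is reached; the resulting pieces are pages. A section is the set of horizontal bonds of the polygon lying in a single unit-width column of a single page; a $k$-section is a section with exactly $2k$ horizontal bonds. Bonds to the left (right) of a section are those lying strictly to the left (right) of its column. -}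

module Defs where

open import Data.Bool using (Bool; true; false; T; _∧_; _∨_; not)
open import Data.Nat as ℕ using (ℕ)
open import Data.Integer using (ℤ; _+_; _≤_; _<_; _⊓_; _⊔_; _≤ᵇ_; _≟_; 1ℤ)
open import Data.Product using (Σ; _×_; _,_; proj₁; proj₂)
open import Data.Sum using (_⊎_)
open import Data.List using (List; []; _∷_; _++_; [_]; zip; map; filterᵇ; length)
open import Data.Bool.ListAction using (any; all)
open import Data.List.Relation.Unary.All using (All)
open import Data.List.Relation.Unary.Unique.Propositional using (Unique)
open import Data.List.Membership.Propositional using (_∈_)
open import Relation.Binary.PropositionalEquality using (_≡_)
open import Relation.Nullary using (does)
open import Function.Bundles using (_⇔_)

Point : Set
Point = ℤ × ℤ

Adj : Point → Point → Set
Adj (a , b) (c , d) =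
  (c ≡ a + 1ℤ × d ≡ b) ⊎ (a ≡ c + 1ℤ × d ≡ b) ⊎
  (c ≡ a × d ≡ b + 1ℤ) ⊎ (c ≡ a × b ≡ d + 1ℤ)

cyclicPairs : {A : Set} → List A → List (A × A)
cyclicPairs [] = []
cyclicPairs (v ∷ vs) = zip (v ∷ vs) (vs ++ [ v ])

record SAP : Set where
  field
    verts    : List Point
    long     : 4 ℕ.≤ length verts
    distinct : Unique verts
    closed   : All (λ pq → Adj (proj₁ pq) (proj₂ pq)) (cyclicPairs verts)
open SAP public

eqℤ : ℤ → ℤ → Bool
eqℤ a b = does (a ≟ b)

isVertStep : Point × Point → Bool
isVertStep ((a , _) , (c , _)) = eqℤ a c

-- vertical bond (a , j) = bond from (a , j) to (a , j + 1)
vpos : Point × Point → Point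
vpos ((a , b) , (_ , d)) = (a , b ⊓ d)

-- horizontal bond (x , y) = bond from (x , y) to (x + 1 , y)
hpos : Point × Point → Point
hpos ((a , b) , (c , _)) = (a ⊓ c , b)

vbonds : SAP → List Point
vbonds P = map vpos (filterᵇ isVertStep (cyclicPairs (verts P)))

hbonds : SAP → List Point
hbonds P = map hpos (filterᵇ (λ e → not (isVertStep e)) (cyclicPairs (verts P)))

-- Section lines in row j (centre height j + 1/2).  The ray from -∞ is
-- stopped at column x or before (i.e. it does not cover the interior of
-- the unit column [x, x+1]) iff some vertical bond (a , j) has a ≤ x;
-- the ray from +∞ similarly iff some vertical bond (a , j) has x + 1 ≤ a.
blockedLeftBy : SAP → ℤ → ℤ → Bool
blockedLeftBy P x j = any (λ v → eqℤ (proj₂ v) j ∧ (proj₁ v ≤ᵇ x)) (vbonds P)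

blockedRightBy : SAP → ℤ → ℤ → Bool
blockedRightBy P x j = any (λ v → eqℤ (proj₂ v) j ∧ ((x + 1ℤ) ≤ᵇ proj₁ v)) (vbonds P)

-- The column [x, x+1] is NOT cut at height j + 1/2.
uncut : SAP → ℤ → ℤ → Bool
uncut P x j = blockedLeftBy P x j ∧ blockedRightBy P x j

-- Heights y and y' in column x lie in the same page: no cut crosses the
-- column strictly between them.
SamePage : SAP → ℤ → ℤ → ℤ → Set
SamePage P x y y' = ∀ j → y ⊓ y' ≤ j → j < y ⊔ y' → T (uncut P x j)

-- A vertical bond (a , j) obstructs a section line: it is the leftmost or
-- the rightmost vertical bond of the polygon in row j.
obstructs : SAP → Point → Bool
obstructs P (a , j) =
  all (λ v → not (eqℤ (proj₂ v) j) ∨ (a ≤ᵇ proj₁ v)) (vbonds P) ∨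
  all (λ v → not (eqℤ (proj₂ v) j) ∨ (proj₁ v ≤ᵇ a)) (vbonds P)

-- The section of P through the horizontal bond (x , y0) (in column x) is a
-- k-section: it consists of exactly 2k horizontal bonds.
KSection : SAP → ℕ → ℤ → ℤ → Set
KSection P k x y0 =
  (x , y0) ∈ hbonds P ×
  Σ (List ℤ) (λ ys → Unique ys × length ys ≡ 2 ℕ.* k ×
     (∀ y → (y ∈ ys) ⇔ ((x , y) ∈ hbonds P × SamePage P x y0 y)))

-- vertical bonds to the left / right of column x (left: on or left of the
-- line X = x; right: on or right of X = x + 1)
leftV : SAP → ℤ → List Point
leftV P x = filterᵇ (λ v → proj₁ v ≤ᵇ x) (vbonds P)

rightV : SAP → ℤ → List Point
rightV P x = filterᵇ (λ v → (x + 1ℤ) ≤ᵇ proj₁ v) (vbonds P)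

-- P contains exactly one k-section (sections being sets of bonds: two
-- representatives give the same section iff same column and same page).
ExactlyOneKSection : SAP → ℕ → Set
ExactlyOneKSection P k =
  Σ ℤ (λ x → Σ ℤ (λ y0 → KSection P k x y0 ×
    (∀ x' y' → KSection P k x' y' → x' ≡ x × SamePage P x y0 y')))

{-# OPTIONS --safe #-}
module Submission where

-- Fix a k-section in column x and one side of it (the columns ≤ x, or the columns ≥ x + 1), and let
-- L j count that side's vertical bonds in row j. The polygon crosses the boundary of the set of that
-- side's vertices at height j + 1 an even number of times, so L j + L (j + 1) + [(x , j + 1) is a bond]
-- is even: L changes parity at every height of the section above its lowest one. The rows spanned by
-- the section are uncut, so L j ≥ 1 on at least 2k − 1 rows, each of which also has an obstructing
-- bond on that side; and the 2k − 2 parity changes force k − 1 of these rows to have L j ≥ 2. This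
-- gives 3k − 2 bonds on each side, 6k − 4 in all. The bound is attained by the unit square for k = 1
-- and, for k ≥ 2, by a comb whose column 1 carries 2k horizontal bonds on one page while every other
-- column carries fewer than 2k.

open import Data.Bool using (Bool; true; false; T; _∧_; _∨_; not; _xor_)
open import Data.Bool.ListAction using (any; all)
open import Data.Bool.Properties using (T-≡; xor-same; xor-comm; xor-assoc; not-involutive)
open import Data.Empty using (⊥; ⊥-elim)
open import Data.Integer as ℤ using (ℤ; +_; 1ℤ; +≤+; +<+; _≤ᵇ_)
import Data.Integer.Properties as ℤ
open import Data.List using (List; []; _∷_; _++_; [_]; zip; map; filterᵇ; length; upTo)
import Data.List.Extrema ℤ.≤-totalOrder as Extrema
open import Data.List.Membership.Propositional using (_∈_; find; lose)
open import Data.List.Membership.Propositional.Properties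
  using (∈-filter⁺; ∈-filter⁻; ∈-map⁺; ∈-map⁻; ∈-++⁻; ∈-++⁺ˡ; ∈-++⁺ʳ; ∈-upTo⁺; ∈-upTo⁻)
open import Data.List.Properties using (length-map; length-++; length-upTo; map-∘; map-++)
open import Data.List.Relation.Binary.Disjoint.Propositional using (Disjoint)
open import Data.List.Relation.Unary.All as All using (All; []; _∷_)
import Data.List.Relation.Unary.All.Properties as All
open import Data.List.Relation.Unary.AllPairs using ([]; _∷_)
open import Data.List.Relation.Unary.Any using (here; there)
open import Data.List.Relation.Unary.Any.Properties using (any⁺; any⁻)
open import Data.List.Relation.Unary.Unique.Propositional using (Unique)
import Data.List.Relation.Unary.Unique.Propositional.Properties as Unique
open import Data.Nat using (ℕ; zero; suc; _+_; _*_; _∸_; _≤_; _<_; z≤n; s≤s)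
open import Data.Nat.Properties
open import Algebra.Properties.CommutativeSemigroup +-commutativeSemigroup using (interchange)
open import Data.Nat.Solver using (module +-*-Solver)
open import Data.Product using (Σ; ∃; _×_; _,_; proj₁; proj₂)
open import Data.Product.Relation.Binary.Pointwise.NonDependent using (×-decidable; ≡×≡⇒≡; ≡⇒≡×≡)
open import Data.Sum using (_⊎_; inj₁; inj₂)
open import Data.Unit using (tt)
open import Function using (_∘_; id)
open import Function.Bundles using (Equivalence; mk⇔)
open import Relation.Binary.Definitions using (DecidableEquality; tri<; tri≈; tri>)
open import Relation.Binary.PropositionalEquality hiding ([_])
open import Relation.Nullary using (¬_; does; yes; no)
open import Relation.Nullary.Decidable using (T?; map′)
open import Defs

T-∧⁺ : {a b : Bool} → T a → T b → T (a ∧ b)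
T-∧⁺ {true} _ tb = tb

T-∧⁻ˡ : {a b : Bool} → T (a ∧ b) → T a
T-∧⁻ˡ {true} _ = tt

T-∧⁻ʳ : {a b : Bool} → T (a ∧ b) → T b
T-∧⁻ʳ {true} tb = tb

T-∨⁺ˡ : {a b : Bool} → T a → T (a ∨ b)
T-∨⁺ˡ {true} _ = tt

T-∨⁺ʳ : {a b : Bool} → T b → T (a ∨ b)
T-∨⁺ʳ {true} _ = tt
T-∨⁺ʳ {false} tb = tb

bit : Bool → ℕ
bit true = 1
bit false = 0

bit-mono : {a b : Bool} → (T a → T b) → bit a ≤ bit b
bit-mono {false} f = z≤n
bit-mono {true} {true} f = ≤-refl
bit-mono {true} {false} f = ⊥-elim (f tt)

count : {A : Set} → (A → Bool) → List A → ℕ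
count p [] = 0
count p (x ∷ xs) = bit (p x) + count p xs

module _ {A : Set} where

  length-filterᵇ : (p : A → Bool) (xs : List A) → length (filterᵇ p xs) ≡ count p xs
  length-filterᵇ p [] = refl
  length-filterᵇ p (x ∷ xs) with p x
  ... | true = cong suc (length-filterᵇ p xs)
  ... | false = length-filterᵇ p xs

  count-filterᵇ : (p q : A → Bool) (xs : List A) →
    count p (filterᵇ q xs) ≡ count (λ x → q x ∧ p x) xs
  count-filterᵇ p q [] = refl
  count-filterᵇ p q (x ∷ xs) with q x
  ... | true = cong (_+_ (bit (p x))) (count-filterᵇ p q xs)
  ... | false = count-filterᵇ p q xs

  count-map : {B : Set} (p : B → Bool) (f : A → B) (xs : List A) →
    count p (map f xs) ≡ count (λ x → p (f x)) xs
  count-map p f [] = refl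
  count-map p f (x ∷ xs) = cong (_+_ (bit (p (f x)))) (count-map p f xs)

  count-++ : (p : A → Bool) (xs ys : List A) → count p (xs ++ ys) ≡ count p xs + count p ys
  count-++ p [] ys = refl
  count-++ p (x ∷ xs) ys = trans (cong (_+_ (bit (p x))) (count-++ p xs ys)) (sym (+-assoc (bit (p x)) _ _))

  count-partition : (q p : A → Bool) (xs : List A) →
    count p xs ≡ count (λ x → q x ∧ p x) xs + count (λ x → not (q x) ∧ p x) xs
  count-partition q p [] = refl
  count-partition q p (x ∷ xs) with q x | p x
  ... | true  | true  = cong suc (count-partition q p xs)
  ... | true  | false = count-partition q p xs
  ... | false | true  = trans (cong suc (count-partition q p xs)) (sym (+-suc _ _))
  ... | false | false = count-partition q p xs

  count-congᴬ : {Q : A → Set} (p p′ : A → Bool) {xs : List A} → All Q xs →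
    (∀ x → Q x → p x ≡ p′ x) → count p xs ≡ count p′ xs
  count-congᴬ p p′ [] h = refl
  count-congᴬ p p′ (qx ∷ qxs) h = cong₂ _+_ (cong bit (h _ qx)) (count-congᴬ p p′ qxs h)

  count-monoᴬ : {Q : A → Set} (p p′ : A → Bool) {xs : List A} → All Q xs →
    (∀ x → Q x → T (p x) → T (p′ x)) → count p xs ≤ count p′ xs
  count-monoᴬ p p′ [] h = z≤n
  count-monoᴬ p p′ (qx ∷ qxs) h = +-mono-≤ (bit-mono (h _ qx)) (count-monoᴬ p p′ qxs h)

  count-mono : (p p′ : A → Bool) (xs : List A) →
    (∀ x → T (p x) → T (p′ x)) → count p xs ≤ count p′ xs
  count-mono p p′ xs h = count-monoᴬ p p′ (All.universal (λ _ → tt) xs) (λ x _ → h x)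

  count-∨ : (p q : A → Bool) (xs : List A) → count (λ x → p x ∨ q x) xs ≤ count p xs + count q xs
  count-∨ p q [] = z≤n
  count-∨ p q (x ∷ xs) with p x | q x
  ... | true  | true  = s≤s (≤-trans (count-∨ p q xs) (+-monoʳ-≤ (count p xs) (n≤1+n _)))
  ... | true  | false = s≤s (count-∨ p q xs)
  ... | false | true  = ≤-trans (s≤s (count-∨ p q xs)) (≤-reflexive (sym (+-suc _ _)))
  ... | false | false = count-∨ p q xs

  count-∨-disjoint : (p q : A → Bool) (xs : List A) → (∀ x → T (p x) → T (q x) → ⊥) →
    count (λ x → p x ∨ q x) xs ≡ count p xs + count q xs
  count-∨-disjoint p q [] h = refl
  count-∨-disjoint p q (x ∷ xs) h with p x | q x | h x
  ... | true  | true  | hx = ⊥-elim (hx tt tt)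
  ... | true  | false | hx = cong suc (count-∨-disjoint p q xs h)
  ... | false | true  | hx = trans (cong suc (count-∨-disjoint p q xs h)) (sym (+-suc _ _))
  ... | false | false | hx = count-∨-disjoint p q xs h

  count≤length : (p : A → Bool) (xs : List A) → count p xs ≤ length xs
  count≤length p [] = z≤n
  count≤length p (x ∷ xs) with p x
  ... | true = s≤s (count≤length p xs)
  ... | false = m≤n⇒m≤1+n (count≤length p xs)

  ∈⇒1≤count : (p : A → Bool) {x : A} {xs : List A} → x ∈ xs → T (p x) → 1 ≤ count p xs
  ∈⇒1≤count p {x} (here refl) px with p x
  ... | true = s≤s z≤n
  ∈⇒1≤count p {xs = y ∷ ys} (there x∈ys) px = ≤-trans (∈⇒1≤count p x∈ys px) (m≤n+m _ (bit (p y)))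

  1≤count⇒∈ : (p : A → Bool) (xs : List A) → 1 ≤ count p xs → ∃ λ x → x ∈ xs × T (p x)
  1≤count⇒∈ p (x ∷ xs) h with p x in eq
  ... | true = x , here refl , subst T (sym eq) tt
  ... | false = let (y , y∈xs , py) = 1≤count⇒∈ p xs h in y , there y∈xs , py

-- Crossings of a closed walk

odd : ℕ → Bool
odd zero = false
odd (suc n) = not (odd n)

odd-+ : ∀ m n → odd (m + n) ≡ odd m xor odd n
odd-+ zero n = refl
odd-+ (suc m) n rewrite odd-+ m n with odd m
... | true = not-involutive (odd n)
... | false = refl

odd-bit : ∀ b → odd (bit b) ≡ b
odd-bit true = refl
odd-bit false = refl

module _ {A : Set} where

  crosses : (A → Bool) → A × A → Bool
  crosses s e = s (proj₁ e) xor s (proj₂ e)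

  walkPairs : A → List A → List (A × A)
  walkPairs a [] = []
  walkPairs a (b ∷ bs) = (a , b) ∷ walkPairs b bs

  walkEnd : A → List A → A
  walkEnd a [] = a
  walkEnd a (b ∷ bs) = walkEnd b bs

  odd-count-crosses-walk : (s : A → Bool) (a : A) (bs : List A) →
    odd (count (crosses s) (walkPairs a bs)) ≡ s a xor s (walkEnd a bs)
  odd-count-crosses-walk s a [] = sym (xor-same (s a))
  odd-count-crosses-walk s a (b ∷ bs) = begin
    odd (bit (crosses s (a , b)) + count (crosses s) (walkPairs b bs))
      ≡⟨ odd-+ (bit (crosses s (a , b))) _ ⟩
    odd (bit (s a xor s b)) xor odd (count (crosses s) (walkPairs b bs))
      ≡⟨ cong₂ _xor_ (odd-bit (s a xor s b)) (odd-count-crosses-walk s b bs) ⟩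
    (s a xor s b) xor (s b xor s z)
      ≡⟨ xor-assoc (s a) (s b) _ ⟩
    s a xor (s b xor (s b xor s z))
      ≡⟨ cong (s a xor_) (sym (xor-assoc (s b) (s b) (s z))) ⟩
    s a xor ((s b xor s b) xor s z)
      ≡⟨ cong (λ t → s a xor (t xor s z)) (xor-same (s b)) ⟩
    s a xor s z ∎
    where
      open ≡-Reasoning
      z : A
      z = walkEnd b bs

  cyclicPairs≡walkPairs : (v : A) (vs : List A) → cyclicPairs (v ∷ vs) ≡ walkPairs v (vs ++ [ v ])
  cyclicPairs≡walkPairs v vs = go v vs
    where
      go : (a : A) (bs : List A) → zip (a ∷ bs) (bs ++ [ v ]) ≡ walkPairs a (bs ++ [ v ])
      go a [] = refl
      go a (b ∷ bs) = cong ((a , b) ∷_) (go b bs)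

  walkEnd-snoc : (a : A) (bs : List A) (z : A) → walkEnd a (bs ++ [ z ]) ≡ z
  walkEnd-snoc a [] z = refl
  walkEnd-snoc a (b ∷ bs) z = walkEnd-snoc b bs z

  even-count-crosses-cycle : (s : A → Bool) (vs : List A) →
    odd (count (crosses s) (cyclicPairs vs)) ≡ false
  even-count-crosses-cycle s [] = refl
  even-count-crosses-cycle s (v ∷ vs) rewrite cyclicPairs≡walkPairs v vs =
    trans (odd-count-crosses-walk s v (vs ++ [ v ]))
          (trans (cong (λ z → s v xor s z) (walkEnd-snoc v vs v)) (xor-same (s v)))

sum≤1 : {a b : ℕ} → a ≤ 1 → b ≤ 1 → (1 ≤ a → 1 ≤ b → ⊥) → a + b ≤ 1
sum≤1 {zero} _ b≤1 _ = b≤1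
sum≤1 {suc a} {zero} a≤1 _ _ = ≤-trans (≤-reflexive (+-identityʳ (suc a))) a≤1
sum≤1 {suc a} {suc b} _ _ both = ⊥-elim (both (s≤s z≤n) (s≤s z≤n))

-- Unlike Data.Product.Properties.≡-dec, this decides by the conjunction of the componentwise tests,
-- so that comparing points reduces to eqℤ … ∧ eqℤ … .
_×-≟_ : {A B : Set} → DecidableEquality A → DecidableEquality B → DecidableEquality (A × B)
(_≟₁_ ×-≟ _≟₂_) p q = map′ ≡×≡⇒≡ ≡⇒≡×≡ (×-decidable _≟₁_ _≟₂_ p q)

module Occurrences {A : Set} (_≟_ : DecidableEquality A) where

  _==_ : A → A → Bool
  a == b = does (a ≟ b)

  ==-sound : {a b : A} → T (a == b) → a ≡ b
  ==-sound {a} {b} t with a ≟ b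
  ... | yes a≡b = a≡b

  ==-complete : {a b : A} → a ≡ b → T (a == b)
  ==-complete {a} {b} a≡b with a ≟ b
  ... | yes _ = tt
  ... | no a≢b = a≢b a≡b

  count-==-∉ : (a : A) {xs : List A} → All (a ≢_) xs → count (_== a) xs ≡ 0
  count-==-∉ a [] = refl
  count-==-∉ a {x ∷ xs} (a≢x ∷ a∉xs) with x ≟ a
  ... | yes x≡a = ⊥-elim (a≢x (sym x≡a))
  ... | no _ = count-==-∉ a a∉xs

  count-==-Unique : (a : A) {xs : List A} → Unique xs → count (_== a) xs ≤ 1
  count-==-Unique a [] = z≤n
  count-==-Unique a {x ∷ xs} (x∉xs ∷ uniq) with x ≟ a
  ... | yes refl = s≤s (≤-reflexive (count-==-∉ x x∉xs))
  ... | no _ = count-==-Unique a uniq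

module SimpleCycle {A : Set} (_≟_ : DecidableEquality A) where

  open Occurrences _≟_
  open Occurrences (_≟_ ×-≟ _≟_) using ()
    renaming (_==_ to _==ₑ_; ==-sound to ==ₑ-sound)

  joins : A → A → A × A → Bool
  joins p q e = (e ==ₑ (p , q)) ∨ (e ==ₑ (q , p))

  count-zip-proj₁ : {B : Set} (f : A → Bool) (xs : List A) (ys : List B) →
    count (f ∘ proj₁) (zip xs ys) ≤ count f xs
  count-zip-proj₁ f [] ys = z≤n
  count-zip-proj₁ f (x ∷ xs) [] = z≤n
  count-zip-proj₁ f (x ∷ xs) (y ∷ ys) = +-monoʳ-≤ (bit (f x)) (count-zip-proj₁ f xs ys)

  count-source-cyclicPairs : (a : A) {vs : List A} → Unique vs →
    count ((_== a) ∘ proj₁) (cyclicPairs vs) ≤ 1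
  count-source-cyclicPairs a {[]} _ = z≤n
  count-source-cyclicPairs a {v ∷ vs} uniq =
    ≤-trans (count-zip-proj₁ (_== a) (v ∷ vs) (vs ++ [ v ])) (count-==-Unique a uniq)

  count-==ₑ-cyclicPairs : (p q : A) {vs : List A} → Unique vs →
    count (_==ₑ (p , q)) (cyclicPairs vs) ≤ 1
  count-==ₑ-cyclicPairs p q {vs} uniq =
    ≤-trans (count-mono _ _ (cyclicPairs vs) source) (count-source-cyclicPairs p uniq)
    where
      source : ∀ e → T (e ==ₑ (p , q)) → T (proj₁ e == p)
      source e t = ==-complete (cong proj₁ (==ₑ-sound t))

  walkPairs-∈⁻ : {p q a : A} (cs : List A) → (p , q) ∈ walkPairs a cs → p ∈ a ∷ cs × q ∈ cs
  walkPairs-∈⁻ (b ∷ cs) (here refl) = here refl , here refl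
  walkPairs-∈⁻ (b ∷ cs) (there pq∈) =
    let (p∈ , q∈) = walkPairs-∈⁻ cs pq∈ in there p∈ , there q∈

  walkPairs-antiparallel : {p q : A} (a : A) (cs : List A) → Unique (a ∷ cs) →
    (p , q) ∈ walkPairs a cs → (q , p) ∈ walkPairs a cs → ⊥
  walkPairs-antiparallel a (b ∷ cs) ((a≢b ∷ _) ∷ _) (here refl) (here eq) = a≢b (sym (cong proj₁ eq))
  walkPairs-antiparallel a (b ∷ cs) ((_ ∷ a∉cs) ∷ _) (here refl) (there ba∈) =
    All.lookup a∉cs (proj₂ (walkPairs-∈⁻ cs ba∈)) refl
  walkPairs-antiparallel a (b ∷ cs) ((_ ∷ a∉cs) ∷ _) (there ba∈) (here refl) =
    All.lookup a∉cs (proj₂ (walkPairs-∈⁻ cs ba∈)) refl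
  walkPairs-antiparallel a (b ∷ cs) (_ ∷ uniq) (there pq∈) (there qp∈) =
    walkPairs-antiparallel b cs uniq pq∈ qp∈

  Unique-rotate : (v : A) (ws : List A) → Unique (v ∷ ws) → Unique (ws ++ [ v ])
  Unique-rotate v ws (v∉ws ∷ uniq) = Unique.++⁺ uniq ([] ∷ []) disjoint
    where
      disjoint : ∀ {u} → u ∈ ws × u ∈ [ v ] → ⊥
      disjoint (u∈ws , here refl) = All.lookup v∉ws u∈ws refl

  cyclicPairs-antiparallel : {p q : A} (vs : List A) → Unique vs → 3 ≤ length vs →
    (p , q) ∈ cyclicPairs vs → (q , p) ∈ cyclicPairs vs → ⊥
  cyclicPairs-antiparallel {p} {q} (v ∷ w ∷ u ∷ us) uniq (s≤s (s≤s (s≤s z≤n)))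
    rewrite cyclicPairs≡walkPairs v (w ∷ u ∷ us) = antiparallel
    where
      ds : List A
      ds = u ∷ us ++ [ v ]
      rotated : Unique (w ∷ ds)
      rotated = Unique-rotate v (w ∷ u ∷ us) uniq
      v≢w : v ≢ w
      v≢w v≡w = Unique.Unique[x∷xs]⇒x∉xs uniq (here v≡w)
      v≢u : v ≢ u
      v≢u v≡u = Unique.Unique[x∷xs]⇒x∉xs uniq (there (here v≡u))
      reversed-first : (w , v) ∈ walkPairs w ds → ⊥
      reversed-first (here eq) = v≢u (cong proj₂ eq)
      reversed-first (there wv∈) = Unique.Unique[x∷xs]⇒x∉xs rotated (proj₁ (walkPairs-∈⁻ (us ++ [ v ]) wv∈))
      antiparallel : (p , q) ∈ (v , w) ∷ walkPairs w ds → (q , p) ∈ (v , w) ∷ walkPairs w ds → ⊥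
      antiparallel (here refl) (here eq) = v≢w (sym (cong proj₁ eq))
      antiparallel (here refl) (there wv∈) = reversed-first wv∈
      antiparallel (there wv∈) (here refl) = reversed-first wv∈
      antiparallel (there pq∈) (there qp∈) = walkPairs-antiparallel w ds rotated pq∈ qp∈

  count-joins-cyclicPairs : (p q : A) {vs : List A} → Unique vs → 3 ≤ length vs →
    count (joins p q) (cyclicPairs vs) ≤ 1
  count-joins-cyclicPairs p q {vs} uniq 3≤ =
    ≤-trans (count-∨ _ _ (cyclicPairs vs))
      (sum≤1 (count-==ₑ-cyclicPairs p q uniq) (count-==ₑ-cyclicPairs q p uniq) both)
    where
      present : (e : A × A) → 1 ≤ count (_==ₑ e) (cyclicPairs vs) → e ∈ cyclicPairs vs
      present e h with 1≤count⇒∈ (_==ₑ e) (cyclicPairs vs) h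
      ... | f , f∈ , t = subst (_∈ cyclicPairs vs) (==ₑ-sound t) f∈
      both : 1 ≤ count (_==ₑ (p , q)) (cyclicPairs vs) → 1 ≤ count (_==ₑ (q , p)) (cyclicPairs vs) → ⊥
      both h₁ h₂ = cyclicPairs-antiparallel vs uniq 3≤ (present (p , q) h₁) (present (q , p) h₂)

eqℤ-refl : (a : ℤ) → eqℤ a a ≡ true
eqℤ-refl a with a ℤ.≟ a
... | yes _ = refl
... | no a≢a = ⊥-elim (a≢a refl)

eqℤ-sound : {a b : ℤ} → T (eqℤ a b) → a ≡ b
eqℤ-sound {a} {b} t with a ℤ.≟ b
... | yes a≡b = a≡b

eqℤ-≢ : {a b : ℤ} → a ≢ b → eqℤ a b ≡ false
eqℤ-≢ {a} {b} a≢b with a ℤ.≟ b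
... | yes a≡b = ⊥-elim (a≢b a≡b)
... | no _ = refl

T-eqℤ-refl : (a : ℤ) → T (eqℤ a a)
T-eqℤ-refl a = subst T (sym (eqℤ-refl a)) tt

i+1≡suc[i] : (i : ℤ) → i ℤ.+ 1ℤ ≡ ℤ.suc i
i+1≡suc[i] i = ℤ.+-comm i 1ℤ

+1-injective : {i j : ℤ} → i ℤ.+ 1ℤ ≡ j ℤ.+ 1ℤ → i ≡ j
+1-injective {i} {j} eq = begin
  i                      ≡⟨ ℤ.pred-suc i ⟨
  ℤ.pred (ℤ.suc i)       ≡⟨ cong ℤ.pred (trans (sym (i+1≡suc[i] i)) (trans eq (i+1≡suc[i] j))) ⟩
  ℤ.pred (ℤ.suc j)       ≡⟨ ℤ.pred-suc j ⟩
  j                      ∎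
  where open ≡-Reasoning

i<i+1 : (i : ℤ) → i ℤ.< i ℤ.+ 1ℤ
i<i+1 i = ℤ.suc[i]≤j⇒i<j (ℤ.≤-reflexive (sym (i+1≡suc[i] i)))

i≤i+1 : (i : ℤ) → i ℤ.≤ i ℤ.+ 1ℤ
i≤i+1 i = ℤ.<⇒≤ (i<i+1 i)

<⇒+1≤ : {i j : ℤ} → i ℤ.< j → i ℤ.+ 1ℤ ℤ.≤ j
<⇒+1≤ {i} i<j = subst (ℤ._≤ _) (sym (i+1≡suc[i] i)) (ℤ.i<j⇒suc[i]≤j i<j)

+1≤⇒< : {i j : ℤ} → i ℤ.+ 1ℤ ℤ.≤ j → i ℤ.< j
+1≤⇒< {i} i+1≤j = ℤ.suc[i]≤j⇒i<j (subst (ℤ._≤ _) (i+1≡suc[i] i) i+1≤j)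

eqℤ-i-i+1 : (i : ℤ) → eqℤ i (i ℤ.+ 1ℤ) ≡ false
eqℤ-i-i+1 i = eqℤ-≢ (λ eq → ℤ.<-irrefl eq (i<i+1 i))

eqℤ-i+1-i : (i : ℤ) → eqℤ (i ℤ.+ 1ℤ) i ≡ false
eqℤ-i+1-i i = eqℤ-≢ (λ eq → ℤ.<-irrefl (sym eq) (i<i+1 i))

eqℤ-+1 : (a b : ℤ) → eqℤ (a ℤ.+ 1ℤ) (b ℤ.+ 1ℤ) ≡ eqℤ a b
eqℤ-+1 a b with a ℤ.≟ b
... | yes refl = eqℤ-refl (a ℤ.+ 1ℤ)
... | no a≢b = eqℤ-≢ (a≢b ∘ +1-injective)

i⊓i+1≡i : (i : ℤ) → i ℤ.⊓ (i ℤ.+ 1ℤ) ≡ i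
i⊓i+1≡i i = ℤ.i≤j⇒i⊓j≡i (i≤i+1 i)

i+1⊓i≡i : (i : ℤ) → (i ℤ.+ 1ℤ) ℤ.⊓ i ≡ i
i+1⊓i≡i i = ℤ.i≥j⇒i⊓j≡j (i≤i+1 i)

+[1+n]≡+n+1 : (m : ℤ) (n : ℕ) → m ℤ.+ + suc n ≡ (m ℤ.+ + n) ℤ.+ 1ℤ
+[1+n]≡+n+1 m n = trans (cong (λ t → m ℤ.+ + t) (+-comm 1 n)) (sym (ℤ.+-assoc m (+ n) 1ℤ))

+[1+n]≡+1+n : (m : ℤ) (n : ℕ) → m ℤ.+ + suc n ≡ (m ℤ.+ 1ℤ) ℤ.+ + n
+[1+n]≡+1+n m n = sym (ℤ.+-assoc m 1ℤ (+ n))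

_≟ₚ_ : DecidableEquality Point
_≟ₚ_ = ℤ._≟_ ×-≟ ℤ._≟_

open Occurrences _≟ₚ_ using () renaming (_==_ to _==ₚ_; ==-sound to ==ₚ-sound; ==-complete to ==ₚ-complete)
open Occurrences (_≟ₚ_ ×-≟ _≟ₚ_) using () renaming (_==_ to _==ₑ_; ==-complete to ==ₑ-complete)
open SimpleCycle _≟ₚ_ using (joins; count-joins-cyclicPairs)

steps : SAP → List (Point × Point)
steps P = cyclicPairs (verts P)

horizontal-step-joins : (b : Point) (e : Point × Point) → Adj (proj₁ e) (proj₂ e) →
  T (not (isVertStep e) ∧ (hpos e ==ₚ b)) → T (joins b (proj₁ b ℤ.+ 1ℤ , proj₂ b) e)
horizontal-step-joins b ((a , c) , (.(a ℤ.+ 1ℤ) , .c)) (inj₁ (refl , refl)) t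
  rewrite eqℤ-i-i+1 a | i⊓i+1≡i a with ==ₚ-sound {a , c} {b} t
... | refl = T-∨⁺ˡ (==ₑ-complete {(a , c) , (a ℤ.+ 1ℤ , c)} refl)
horizontal-step-joins b ((.(a ℤ.+ 1ℤ) , c) , (a , .c)) (inj₂ (inj₁ (refl , refl))) t
  rewrite eqℤ-i+1-i a | i+1⊓i≡i a with ==ₚ-sound {a , c} {b} t
... | refl = T-∨⁺ʳ {((a ℤ.+ 1ℤ , c) , (a , c)) ==ₑ ((a , c) , (a ℤ.+ 1ℤ , c))}
                   (==ₑ-complete {(a ℤ.+ 1ℤ , c) , (a , c)} refl)
horizontal-step-joins b ((a , c) , (.a , .(c ℤ.+ 1ℤ))) (inj₂ (inj₂ (inj₁ (refl , refl)))) t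
  rewrite eqℤ-refl a = ⊥-elim t
horizontal-step-joins b ((a , .(c ℤ.+ 1ℤ)) , (.a , c)) (inj₂ (inj₂ (inj₂ (refl , refl)))) t
  rewrite eqℤ-refl a = ⊥-elim t

count-hbonds≤1 : (P : SAP) (b : Point) → count (_==ₚ b) (hbonds P) ≤ 1
count-hbonds≤1 P b = begin
  count (_==ₚ b) (hbonds P)
    ≡⟨ count-map (_==ₚ b) hpos (filterᵇ (not ∘ isVertStep) (steps P)) ⟩
  count (λ e → hpos e ==ₚ b) (filterᵇ (not ∘ isVertStep) (steps P))
    ≡⟨ count-filterᵇ (λ e → hpos e ==ₚ b) (not ∘ isVertStep) (steps P) ⟩
  count (λ e → not (isVertStep e) ∧ (hpos e ==ₚ b)) (steps P)
    ≤⟨ count-monoᴬ _ _ (closed P) (horizontal-step-joins b) ⟩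
  count (joins b (proj₁ b ℤ.+ 1ℤ , proj₂ b)) (steps P)
    ≤⟨ count-joins-cyclicPairs _ _ (distinct P) (≤-trans (n≤1+n 3) (long P)) ⟩
  1 ∎
  where open ≤-Reasoning

-- Vertical bonds on one side of a column

∧-xor-disjoint : (s p q : Bool) → p ∧ q ≡ false → (s ∧ p) xor (s ∧ q) ≡ s ∧ (p ∨ q)
∧-xor-disjoint true true true ()
∧-xor-disjoint true true false _ = refl
∧-xor-disjoint true false q _ = refl
∧-xor-disjoint false p q _ = refl

∧-distribʳ-xor : (p q r : Bool) → (p ∧ r) xor (q ∧ r) ≡ (p xor q) ∧ r
∧-distribʳ-xor true true r = xor-same r
∧-distribʳ-xor true false true = refl
∧-distribʳ-xor true false false = refl
∧-distribʳ-xor false q r = refl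

eqℤ-consecutive-disjoint : (d j : ℤ) → eqℤ d j ∧ eqℤ d (j ℤ.+ 1ℤ) ≡ false
eqℤ-consecutive-disjoint d j with d ℤ.≟ j
... | yes refl = eqℤ-i-i+1 d
... | no _ = refl

module Side (P : SAP) (x : ℤ) (side : ℤ → Bool)
            (side-flips : ∀ h → side h xor side (h ℤ.+ 1ℤ) ≡ eqℤ h x) where

  sideV : List Point
  sideV = filterᵇ (side ∘ proj₁) (vbonds P)

  rowCount : ℤ → ℕ
  rowCount j = count (λ v → eqℤ (proj₂ v) j) sideV

  multiplicity : ℤ → ℕ
  multiplicity y = count (_==ₚ (x , y)) (hbonds P)

  level : ℤ → Point → Bool
  level j p = side (proj₁ p) ∧ eqℤ (proj₂ p) (j ℤ.+ 1ℤ)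

  inRows : ℤ → Point → Bool
  inRows j v = side (proj₁ v) ∧ (eqℤ (proj₂ v) j ∨ eqℤ (proj₂ v) (j ℤ.+ 1ℤ))

  vertical-step-crosses : (j : ℤ) (e : Point × Point) → Adj (proj₁ e) (proj₂ e) →
    (isVertStep e ∧ crosses (level j) e) ≡ (isVertStep e ∧ inRows j (vpos e))
  vertical-step-crosses j ((a , b) , (.(a ℤ.+ 1ℤ) , .b)) (inj₁ (refl , refl))
    rewrite eqℤ-i-i+1 a = refl
  vertical-step-crosses j ((.(a ℤ.+ 1ℤ) , b) , (a , .b)) (inj₂ (inj₁ (refl , refl)))
    rewrite eqℤ-i+1-i a = refl
  vertical-step-crosses j ((a , b) , (.a , .(b ℤ.+ 1ℤ))) (inj₂ (inj₂ (inj₁ (refl , refl))))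
    rewrite eqℤ-refl a | i⊓i+1≡i b | eqℤ-+1 b j =
      trans (xor-comm (side a ∧ eqℤ b (j ℤ.+ 1ℤ)) _)
            (∧-xor-disjoint (side a) (eqℤ b j) _ (eqℤ-consecutive-disjoint b j))
  vertical-step-crosses j ((a , .(d ℤ.+ 1ℤ)) , (.a , d)) (inj₂ (inj₂ (inj₂ (refl , refl))))
    rewrite eqℤ-refl a | i+1⊓i≡i d | eqℤ-+1 d j =
      ∧-xor-disjoint (side a) (eqℤ d j) _ (eqℤ-consecutive-disjoint d j)

  horizontal-step-crosses : (j : ℤ) (e : Point × Point) → Adj (proj₁ e) (proj₂ e) →
    (not (isVertStep e) ∧ crosses (level j) e) ≡ (not (isVertStep e) ∧ (hpos e ==ₚ (x , j ℤ.+ 1ℤ)))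
  horizontal-step-crosses j ((a , b) , (.(a ℤ.+ 1ℤ) , .b)) (inj₁ (refl , refl))
    rewrite eqℤ-i-i+1 a | i⊓i+1≡i a =
      trans (∧-distribʳ-xor (side a) (side (a ℤ.+ 1ℤ)) _) (cong (_∧ _) (side-flips a))
  horizontal-step-crosses j ((.(a ℤ.+ 1ℤ) , b) , (a , .b)) (inj₂ (inj₁ (refl , refl)))
    rewrite eqℤ-i+1-i a | i+1⊓i≡i a =
      trans (xor-comm (side (a ℤ.+ 1ℤ) ∧ _) _)
            (trans (∧-distribʳ-xor (side a) (side (a ℤ.+ 1ℤ)) _) (cong (_∧ _) (side-flips a)))
  horizontal-step-crosses j ((a , b) , (.a , .(b ℤ.+ 1ℤ))) (inj₂ (inj₂ (inj₁ (refl , refl))))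
    rewrite eqℤ-refl a = refl
  horizontal-step-crosses j ((a , .(d ℤ.+ 1ℤ)) , (.a , d)) (inj₂ (inj₂ (inj₂ (refl , refl))))
    rewrite eqℤ-refl a = refl

  count-vertical-crossings : (j : ℤ) →
    count (λ e → isVertStep e ∧ crosses (level j) e) (steps P) ≡ rowCount j + rowCount (j ℤ.+ 1ℤ)
  count-vertical-crossings j = begin
    count (λ e → isVertStep e ∧ crosses (level j) e) (steps P)
      ≡⟨ count-congᴬ _ _ (closed P) (vertical-step-crosses j) ⟩
    count (λ e → isVertStep e ∧ inRows j (vpos e)) (steps P)
      ≡⟨ count-filterᵇ (inRows j ∘ vpos) isVertStep (steps P) ⟨
    count (inRows j ∘ vpos) (filterᵇ isVertStep (steps P))
      ≡⟨ count-map (inRows j) vpos (filterᵇ isVertStep (steps P)) ⟨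
    count (inRows j) (vbonds P)
      ≡⟨ count-filterᵇ rows (side ∘ proj₁) (vbonds P) ⟨
    count rows sideV
      ≡⟨ count-∨-disjoint _ _ sideV disjoint ⟩
    rowCount j + rowCount (j ℤ.+ 1ℤ) ∎
    where
      open ≡-Reasoning
      rows : Point → Bool
      rows v = eqℤ (proj₂ v) j ∨ eqℤ (proj₂ v) (j ℤ.+ 1ℤ)
      disjoint : ∀ v → T (eqℤ (proj₂ v) j) → T (eqℤ (proj₂ v) (j ℤ.+ 1ℤ)) → ⊥
      disjoint v t₁ t₂ = subst T (eqℤ-consecutive-disjoint (proj₂ v) j) (T-∧⁺ t₁ t₂)

  count-horizontal-crossings : (j : ℤ) →
    count (λ e → not (isVertStep e) ∧ crosses (level j) e) (steps P) ≡ multiplicity (j ℤ.+ 1ℤ)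
  count-horizontal-crossings j = begin
    count (λ e → not (isVertStep e) ∧ crosses (level j) e) (steps P)
      ≡⟨ count-congᴬ _ _ (closed P) (horizontal-step-crosses j) ⟩
    count (λ e → not (isVertStep e) ∧ (hpos e ==ₚ b)) (steps P)
      ≡⟨ count-filterᵇ (λ e → hpos e ==ₚ b) (not ∘ isVertStep) (steps P) ⟨
    count (λ e → hpos e ==ₚ b) (filterᵇ (not ∘ isVertStep) (steps P))
      ≡⟨ count-map (_==ₚ b) hpos (filterᵇ (not ∘ isVertStep) (steps P)) ⟨
    multiplicity (j ℤ.+ 1ℤ) ∎
    where
      open ≡-Reasoning
      b : Point
      b = (x , j ℤ.+ 1ℤ)

  -- The steps crossing the boundary of level j are this side's vertical bonds in rows j and j + 1
  -- and the horizontal bond (x , j + 1), and a closed walk crosses any boundary an even number of times.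
  even-crossings : (j : ℤ) →
    odd (rowCount j + rowCount (j ℤ.+ 1ℤ) + multiplicity (j ℤ.+ 1ℤ)) ≡ false
  even-crossings j = trans (cong odd (sym split)) (even-count-crosses-cycle (level j) (verts P))
    where
      split : count (crosses (level j)) (steps P) ≡ rowCount j + rowCount (j ℤ.+ 1ℤ) + multiplicity (j ℤ.+ 1ℤ)
      split = trans (count-partition isVertStep (crosses (level j)) (steps P))
                    (cong₂ _+_ (count-vertical-crossings j) (count-horizontal-crossings j))

  multiplicity≡1 : (y : ℤ) → (x , y) ∈ hbonds P → multiplicity y ≡ 1
  multiplicity≡1 y b∈ =
    ≤-antisym (count-hbonds≤1 P (x , y)) (∈⇒1≤count (_==ₚ (x , y)) b∈ (==ₚ-complete {x , y} refl))

  rowCount-parity-flip : (j : ℤ) → (x , j ℤ.+ 1ℤ) ∈ hbonds P →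
    odd (rowCount j) xor odd (rowCount (j ℤ.+ 1ℤ)) ≡ true
  rowCount-parity-flip j b∈ = xor-true (begin
    (odd (rowCount j) xor odd (rowCount (j ℤ.+ 1ℤ))) xor true
      ≡⟨ cong₂ _xor_ (odd-+ (rowCount j) _) (cong odd (multiplicity≡1 _ b∈)) ⟨
    odd (rowCount j + rowCount (j ℤ.+ 1ℤ)) xor odd (multiplicity (j ℤ.+ 1ℤ))
      ≡⟨ odd-+ (rowCount j + rowCount (j ℤ.+ 1ℤ)) _ ⟨
    odd (rowCount j + rowCount (j ℤ.+ 1ℤ) + multiplicity (j ℤ.+ 1ℤ))
      ≡⟨ even-crossings j ⟩
    false ∎)
    where
      open ≡-Reasoning
      xor-true : {b : Bool} → b xor true ≡ false → b ≡ true
      xor-true {true} _ = refl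

  blockedOn : ℤ → Bool
  blockedOn j = any (λ v → eqℤ (proj₂ v) j ∧ side (proj₁ v)) (vbonds P)

  1≤rowCount : (j : ℤ) → T (blockedOn j) → 1 ≤ rowCount j
  1≤rowCount j t with find (any⁻ _ (vbonds P) t)
  ... | v , v∈ , tv = ∈⇒1≤count _ (∈-filter⁺ (T? ∘ side ∘ proj₁) v∈ (T-∧⁻ʳ tv)) (T-∧⁻ˡ tv)

rangeSum : ℤ → ℕ → (ℤ → ℕ) → ℕ
rangeSum m zero f = 0
rangeSum m (suc n) f = f m + rangeSum (m ℤ.+ 1ℤ) n f

rangeSum-+ : (m : ℤ) (n : ℕ) (f g : ℤ → ℕ) →
  rangeSum m n (λ j → f j + g j) ≡ rangeSum m n f + rangeSum m n g
rangeSum-+ m zero f g = refl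
rangeSum-+ m (suc n) f g rewrite rangeSum-+ (m ℤ.+ 1ℤ) n f g = interchange (f m) (g m) _ _

rangeSum-zero : (m : ℤ) (n : ℕ) → rangeSum m n (λ _ → 0) ≡ 0
rangeSum-zero m zero = refl
rangeSum-zero m (suc n) = rangeSum-zero (m ℤ.+ 1ℤ) n

rangeSum-one : (m : ℤ) (n : ℕ) → rangeSum m n (λ _ → 1) ≡ n
rangeSum-one m zero = refl
rangeSum-one m (suc n) = cong suc (rangeSum-one (m ℤ.+ 1ℤ) n)

rangeSum-last : (m : ℤ) (n : ℕ) (f : ℤ → ℕ) → rangeSum m (suc n) f ≡ rangeSum m n f + f (m ℤ.+ + n)
rangeSum-last m zero f rewrite ℤ.+-identityʳ m = +-comm (f m) 0
rangeSum-last m (suc n) f rewrite rangeSum-last (m ℤ.+ 1ℤ) n f | +[1+n]≡+1+n m n =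
  sym (+-assoc (f m) _ _)

rangeSum-mono : (m : ℤ) (n : ℕ) (f g : ℤ → ℕ) →
  (∀ j → m ℤ.≤ j → j ℤ.< m ℤ.+ + n → f j ≤ g j) → rangeSum m n f ≤ rangeSum m n g
rangeSum-mono m zero f g f≤g = z≤n
rangeSum-mono m (suc n) f g f≤g =
  +-mono-≤ (f≤g m ℤ.≤-refl m<end) (rangeSum-mono (m ℤ.+ 1ℤ) n f g shifted)
  where
    m<end : m ℤ.< m ℤ.+ + suc n
    m<end = subst (m ℤ.<_) (sym (+[1+n]≡+1+n m n)) (ℤ.<-≤-trans (i<i+1 m) (ℤ.i≤i+j (m ℤ.+ 1ℤ) (+ n)))
    shifted : ∀ j → m ℤ.+ 1ℤ ℤ.≤ j → j ℤ.< (m ℤ.+ 1ℤ) ℤ.+ + n → f j ≤ g j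
    shifted j m+1≤j j<end = f≤g j (ℤ.≤-trans (i≤i+1 m) m+1≤j) (subst (j ℤ.<_) (sym (+[1+n]≡+1+n m n)) j<end)

rangeSum≤n : (m : ℤ) (n : ℕ) (f : ℤ → ℕ) → (∀ j → f j ≤ 1) → rangeSum m n f ≤ n
rangeSum≤n m n f f≤1 =
  ≤-trans (rangeSum-mono m n f (λ _ → 1) (λ j _ _ → f≤1 j)) (≤-reflexive (rangeSum-one m n))

rangeSum-indicator-below : (z m : ℤ) (n : ℕ) → z ℤ.< m → rangeSum m n (λ j → bit (eqℤ z j)) ≡ 0
rangeSum-indicator-below z m zero z<m = refl
rangeSum-indicator-below z m (suc n) z<m rewrite eqℤ-≢ (λ z≡m → ℤ.<-irrefl z≡m z<m) =
  rangeSum-indicator-below z (m ℤ.+ 1ℤ) n (ℤ.<-trans z<m (i<i+1 m))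

rangeSum-indicator≤1 : (z m : ℤ) (n : ℕ) → rangeSum m n (λ j → bit (eqℤ z j)) ≤ 1
rangeSum-indicator≤1 z m zero = z≤n
rangeSum-indicator≤1 z m (suc n) with z ℤ.≟ m
... | yes refl rewrite rangeSum-indicator-below z (z ℤ.+ 1ℤ) n (i<i+1 z) = s≤s z≤n
... | no _ = rangeSum-indicator≤1 z (m ℤ.+ 1ℤ) n

rangeSum-indicator-in : (z m : ℤ) (n : ℕ) → m ℤ.≤ z → z ℤ.< m ℤ.+ + n →
  rangeSum m n (λ j → bit (eqℤ z j)) ≡ 1
rangeSum-indicator-in z m zero m≤z z<m rewrite ℤ.+-identityʳ m = ⊥-elim (ℤ.<-irrefl refl (ℤ.≤-<-trans m≤z z<m))
rangeSum-indicator-in z m (suc n) m≤z z<end with z ℤ.≟ m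
... | yes refl rewrite rangeSum-indicator-below z (z ℤ.+ 1ℤ) n (i<i+1 z) = refl
... | no z≢m = rangeSum-indicator-in z (m ℤ.+ 1ℤ) n
                 (<⇒+1≤ (ℤ.≤∧≢⇒< m≤z (z≢m ∘ sym))) (subst (z ℤ.<_) (+[1+n]≡+1+n m n) z<end)

module _ {V : Set} (key : V → ℤ) (m : ℤ) (n : ℕ) where

  rangeSum-count≤length : (ys : List V) → rangeSum m n (λ j → count (λ v → eqℤ (key v) j) ys) ≤ length ys
  rangeSum-count≤length [] = ≤-reflexive (rangeSum-zero m n)
  rangeSum-count≤length (v ∷ ys)
    rewrite rangeSum-+ m n (λ j → bit (eqℤ (key v) j)) (λ j → count (λ v → eqℤ (key v) j) ys) =
      +-mono-≤ (rangeSum-indicator≤1 (key v) m n) (rangeSum-count≤length ys)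

  rangeSum-count≡length : (ys : List V) → All (λ v → m ℤ.≤ key v × key v ℤ.< m ℤ.+ + n) ys →
    rangeSum m n (λ j → count (λ v → eqℤ (key v) j) ys) ≡ length ys
  rangeSum-count≡length [] [] = rangeSum-zero m n
  rangeSum-count≡length (v ∷ ys) ((m≤v , v<end) ∷ inRange)
    rewrite rangeSum-+ m n (λ j → bit (eqℤ (key v) j)) (λ j → count (λ v → eqℤ (key v) j) ys) =
      cong₂ _+_ (rangeSum-indicator-in (key v) m n m≤v v<end) (rangeSum-count≡length ys inRange)

changes : (ℤ → Bool) → ℤ → ℕ → ℕ
changes g m zero = 0
changes g m (suc zero) = 0
changes g m (suc (suc n)) = bit (g m xor g (m ℤ.+ 1ℤ)) + changes g (m ℤ.+ 1ℤ) (suc n)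

bit-xor≤ : (a b : Bool) → bit (a xor b) ≤ bit (not a) + bit (not b)
bit-xor≤ true true = z≤n
bit-xor≤ true false = s≤s z≤n
bit-xor≤ false true = s≤s z≤n
bit-xor≤ false false = z≤n

-- Each change happens next to a false entry, and a false entry lies next to at most two changes.
changes≤2*falses : (g : ℤ → Bool) (m : ℤ) (n : ℕ) →
  changes g m (suc n) + bit (not (g m)) ≤ 2 * rangeSum m (suc n) (λ j → bit (not (g j)))
changes≤2*falses g m zero with not (g m)
... | true = s≤s z≤n
... | false = z≤n
changes≤2*falses g m (suc n) = begin
  bit (g m xor g m′) + c + a       ≤⟨ +-monoˡ-≤ a (+-monoˡ-≤ c (bit-xor≤ (g m) (g m′))) ⟩
  a + b + c + a                    ≡⟨ solve 3 (λ a b c → a :+ b :+ c :+ a := (a :+ a) :+ (c :+ b)) refl a b c ⟩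
  (a + a) + (c + b)                ≤⟨ +-monoʳ-≤ (a + a) (changes≤2*falses g m′ n) ⟩
  (a + a) + 2 * R                  ≡⟨ solve 2 (λ a R → (a :+ a) :+ con 2 :* R := con 2 :* (a :+ R)) refl a R ⟩
  2 * (a + R)                      ∎
  where
    open ≤-Reasoning
    open +-*-Solver
    m′ : ℤ
    m′ = m ℤ.+ 1ℤ
    a b c R : ℕ
    a = bit (not (g m))
    b = bit (not (g m′))
    c = changes g m′ (suc n)
    R = rangeSum m′ (suc n) (λ j → bit (not (g j)))

rangeSum≤changes : (g : ℤ → Bool) (h : ℤ → ℕ) (m : ℤ) (n : ℕ) → (∀ j → h j ≤ 1) →
  (∀ j → m ℤ.≤ j → j ℤ.+ 1ℤ ℤ.< m ℤ.+ + suc n → 1 ≤ h (j ℤ.+ 1ℤ) → g j xor g (j ℤ.+ 1ℤ) ≡ true) →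
  rangeSum (m ℤ.+ 1ℤ) n h ≤ changes g m (suc n)
rangeSum≤changes g h m zero h≤1 change = z≤n
rangeSum≤changes g h m (suc n) h≤1 change =
  +-mono-≤ first (rangeSum≤changes g h (m ℤ.+ 1ℤ) n h≤1 change′)
  where
    m+1<end : m ℤ.+ 1ℤ ℤ.< m ℤ.+ + suc (suc n)
    m+1<end = ℤ.+-monoʳ-< m (+<+ (s≤s (s≤s z≤n)))
    first : h (m ℤ.+ 1ℤ) ≤ bit (g m xor g (m ℤ.+ 1ℤ))
    first with h (m ℤ.+ 1ℤ) | h≤1 (m ℤ.+ 1ℤ) | change m ℤ.≤-refl m+1<end
    ... | zero | _ | _ = z≤n
    ... | suc zero | _ | changed rewrite changed (s≤s z≤n) = s≤s z≤n
    ... | suc (suc _) | s≤s () | _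
    change′ : ∀ j → m ℤ.+ 1ℤ ℤ.≤ j → j ℤ.+ 1ℤ ℤ.< (m ℤ.+ 1ℤ) ℤ.+ + suc n →
              1 ≤ h (j ℤ.+ 1ℤ) → g j xor g (j ℤ.+ 1ℤ) ≡ true
    change′ j m+1≤j j+1<end =
      change j (ℤ.≤-trans (i≤i+1 m) m+1≤j) (subst (j ℤ.+ 1ℤ ℤ.<_) (sym (+[1+n]≡+1+n m (suc n))) j+1<end)

2k-marks≤2+2*evens : (f c : ℤ → ℕ) (m : ℤ) (n : ℕ) → (∀ j → c j ≤ 1) →
  (∀ j → m ℤ.≤ j → j ℤ.+ 1ℤ ℤ.< m ℤ.+ + suc n → 1 ≤ c (j ℤ.+ 1ℤ) →
         odd (f j) xor odd (f (j ℤ.+ 1ℤ)) ≡ true) →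
  rangeSum m (suc (suc n)) c ≤ 2 * suc (rangeSum m (suc n) (λ j → bit (not (odd (f j)))))
2k-marks≤2+2*evens f c m n c≤1 change = begin
  c m + rangeSum m′ (suc n) c
    ≡⟨ cong (_+_ (c m)) (rangeSum-last m′ n c) ⟩
  c m + (rangeSum m′ n c + c (m′ ℤ.+ + n))
    ≤⟨ +-mono-≤ (c≤1 m) (+-mono-≤ (rangeSum≤changes g c m n c≤1 change) (c≤1 _)) ⟩
  1 + (changes g m (suc n) + 1)
    ≡⟨ cong suc (+-comm _ 1) ⟩
  2 + changes g m (suc n)
    ≤⟨ +-monoʳ-≤ 2 (m≤m+n _ (bit (not (g m)))) ⟩
  2 + (changes g m (suc n) + bit (not (g m)))
    ≤⟨ +-monoʳ-≤ 2 (changes≤2*falses g m n) ⟩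
  2 + 2 * evens
    ≡⟨ *-suc 2 evens ⟨
  2 * suc evens ∎
  where
    open ≤-Reasoning
    m′ : ℤ
    m′ = m ℤ.+ 1ℤ
    g : ℤ → Bool
    g j = odd (f j)
    evens : ℕ
    evens = rangeSum m (suc n) (λ j → bit (not (g j)))

1+bit-even≤ : (v : ℕ) → 1 ≤ v → 1 + bit (not (odd v)) ≤ v
1+bit-even≤ (suc zero) _ = s≤s z≤n
1+bit-even≤ (suc (suc v)) _ with not (odd (suc (suc v)))
... | true = s≤s (s≤s z≤n)
... | false = s≤s z≤n

3k∸2≤n+a : (k n a : ℕ) → 2 * k ≤ suc n → 2 * k ≤ 2 * suc a → 3 * k ∸ 2 ≤ n + a
3k∸2≤n+a k n a 2k≤1+n 2k≤2+2a = begin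
  3 * k ∸ 2            ≡⟨ cong (_∸ 2) (solve 1 (λ k → con 3 :* k := con 2 :* k :+ k) refl k) ⟩
  (2 * k + k) ∸ 2      ≤⟨ ∸-monoˡ-≤ 2 (+-mono-≤ 2k≤1+n (*-cancelˡ-≤ 2 2k≤2+2a)) ⟩
  (suc n + suc a) ∸ 2  ≡⟨ cong (_∸ 1) (+-suc n a) ⟩
  n + a                ∎
  where
    open ≤-Reasoning
    open +-*-Solver

-- The 2k marks need n ≥ 2k − 1 rows, and the ≥ 2k − 2 parity changes they force need at least
-- k − 1 even, hence ≥ 2, values of f.
3k∸2≤rangeSum : (f c : ℤ → ℕ) (m : ℤ) (n k : ℕ) → (∀ j → c j ≤ 1) → rangeSum m (suc n) c ≡ 2 * k →
  (∀ j → m ℤ.≤ j → j ℤ.< m ℤ.+ + n → 1 ≤ f j) →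
  (∀ j → m ℤ.≤ j → j ℤ.+ 1ℤ ℤ.< m ℤ.+ + n → 1 ≤ c (j ℤ.+ 1ℤ) →
         odd (f j) xor odd (f (j ℤ.+ 1ℤ)) ≡ true) →
  3 * k ∸ 2 ≤ rangeSum m n f
3k∸2≤rangeSum f c m zero k c≤1 total _ _ =
  ≤-trans (3k∸2≤n+a k 0 0 2k≤1 (≤-trans 2k≤1 (s≤s z≤n))) z≤n
  where
    2k≤1 : 2 * k ≤ 1
    2k≤1 = subst (_≤ 1) total (rangeSum≤n m 1 c c≤1)
3k∸2≤rangeSum f c m (suc n) k c≤1 total positive change = begin
  3 * k ∸ 2
    ≤⟨ 3k∸2≤n+a k (suc n) evens 2k≤2+n 2k≤2+2evens ⟩
  suc n + evens
    ≡⟨ cong₂ _+_ (rangeSum-one m (suc n)) refl ⟨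
  rangeSum m (suc n) (λ _ → 1) + evens
    ≡⟨ rangeSum-+ m (suc n) (λ _ → 1) _ ⟨
  rangeSum m (suc n) (λ j → 1 + bit (not (odd (f j))))
    ≤⟨ rangeSum-mono m (suc n) _ f (λ j m≤j j<end → 1+bit-even≤ (f j) (positive j m≤j j<end)) ⟩
  rangeSum m (suc n) f ∎
  where
    open ≤-Reasoning
    evens : ℕ
    evens = rangeSum m (suc n) (λ j → bit (not (odd (f j))))
    2k≤2+n : 2 * k ≤ suc (suc n)
    2k≤2+n = subst (_≤ suc (suc n)) total (rangeSum≤n m (suc (suc n)) c c≤1)
    2k≤2+2evens : 2 * k ≤ 2 * suc evens
    2k≤2+2evens = subst (_≤ 2 * suc evens) total (2k-marks≤2+2*evens f c m n c≤1 change)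

-- Obstructing bonds

rowBonds : SAP → ℤ → List Point
rowBonds P j = filterᵇ (λ w → eqℤ (proj₂ w) j) (vbonds P)

module _ (P : SAP) (j : ℤ) where

  InRow : Point → Set
  InRow w = w ∈ vbonds P × T (eqℤ (proj₂ w) j)

  private
    inRow : ∀ {w} → w ∈ rowBonds P j → InRow w
    inRow = ∈-filter⁻ (T? ∘ λ w → eqℤ (proj₂ w) j)

    ∈-rowBonds : ∀ {w} → InRow w → w ∈ rowBonds P j
    ∈-rowBonds (w∈ , w-in-j) = ∈-filter⁺ (T? ∘ λ w → eqℤ (proj₂ w) j) w∈ w-in-j

    sameRow : {u : Point} (w : Point) → InRow u → T (eqℤ (proj₂ w) (proj₂ u)) → T (eqℤ (proj₂ w) j)
    sameRow w (_ , u-in-j) = subst T (cong (eqℤ (proj₂ w)) (eqℤ-sound u-in-j))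

  leftmost-obstructs : (v : Point) → InRow v →
    let u = Extrema.argmin proj₁ v (rowBonds P j) in InRow u × proj₁ u ℤ.≤ proj₁ v × T (obstructs P u)
  leftmost-obstructs v v-in =
    u-in , Extrema.f[argmin]≤f[⊤] {f = proj₁} v (rowBonds P j) , T-∨⁺ˡ (All.all⁻ _ (All.tabulate leftmost))
    where
      u : Point
      u = Extrema.argmin proj₁ v (rowBonds P j)
      u-in : InRow u
      u-in = Extrema.argmin-all proj₁ v-in (All.tabulate inRow)
      leftmost : ∀ {w} → w ∈ vbonds P → T (not (eqℤ (proj₂ w) (proj₂ u)) ∨ (proj₁ u ≤ᵇ proj₁ w))
      leftmost {w} w∈ with eqℤ (proj₂ w) (proj₂ u) in same
      ... | false = tt
      ... | true = ℤ.≤⇒≤ᵇ (All.lookup (Extrema.f[argmin]≤f[xs] {f = proj₁} v (rowBonds P j)) w∈row)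
        where
          w∈row : w ∈ rowBonds P j
          w∈row = ∈-rowBonds (w∈ , sameRow w u-in (subst T (sym same) tt))

  rightmost-obstructs : (v : Point) → InRow v →
    let u = Extrema.argmax proj₁ v (rowBonds P j) in InRow u × proj₁ v ℤ.≤ proj₁ u × T (obstructs P u)
  rightmost-obstructs v v-in =
    u-in , Extrema.f[⊥]≤f[argmax] {f = proj₁} v (rowBonds P j) ,
    T-∨⁺ʳ {all _ (vbonds P)} (All.all⁻ _ (All.tabulate rightmost))
    where
      u : Point
      u = Extrema.argmax proj₁ v (rowBonds P j)
      u-in : InRow u
      u-in = Extrema.argmax-all proj₁ v-in (All.tabulate inRow)
      rightmost : ∀ {w} → w ∈ vbonds P → T (not (eqℤ (proj₂ w) (proj₂ u)) ∨ (proj₁ w ≤ᵇ proj₁ u))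
      rightmost {w} w∈ with eqℤ (proj₂ w) (proj₂ u) in same
      ... | false = tt
      ... | true = ℤ.≤⇒≤ᵇ (All.lookup (Extrema.f[xs]≤f[argmax] {f = proj₁} v (rowBonds P j)) w∈row)
        where
          w∈row : w ∈ rowBonds P j
          w∈row = ∈-rowBonds (w∈ , sameRow w u-in (subst T (sym same) tt))

obstructing-left : (P : SAP) (x j : ℤ) → T (blockedLeftBy P x j) →
  1 ≤ count (λ v → eqℤ (proj₂ v) j) (filterᵇ (obstructs P) (leftV P x))
obstructing-left P x j blocked with find (any⁻ _ (vbonds P) blocked)
... | v , v∈ , t with leftmost-obstructs P j v (v∈ , T-∧⁻ˡ t)
... | (u∈ , u-in-j) , u≤v , obstructing = ∈⇒1≤count _ u∈obstructing u-in-j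
  where
    u∈left : _ ∈ leftV P x
    u∈left = ∈-filter⁺ (T? ∘ λ w → proj₁ w ≤ᵇ x) u∈
               (ℤ.≤⇒≤ᵇ (ℤ.≤-trans u≤v (ℤ.≤ᵇ⇒≤ (T-∧⁻ʳ t))))
    u∈obstructing : _ ∈ filterᵇ (obstructs P) (leftV P x)
    u∈obstructing = ∈-filter⁺ (T? ∘ obstructs P) u∈left obstructing

obstructing-right : (P : SAP) (x j : ℤ) → T (blockedRightBy P x j) →
  1 ≤ count (λ v → eqℤ (proj₂ v) j) (filterᵇ (obstructs P) (rightV P x))
obstructing-right P x j blocked with find (any⁻ _ (vbonds P) blocked)
... | v , v∈ , t with rightmost-obstructs P j v (v∈ , T-∧⁻ˡ t)
... | (u∈ , u-in-j) , v≤u , obstructing = ∈⇒1≤count _ u∈obstructing u-in-j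
  where
    u∈right : _ ∈ rightV P x
    u∈right = ∈-filter⁺ (T? ∘ λ w → (x ℤ.+ 1ℤ) ≤ᵇ proj₁ w) u∈
                (ℤ.≤⇒≤ᵇ (ℤ.≤-trans (ℤ.≤ᵇ⇒≤ {x ℤ.+ 1ℤ} (T-∧⁻ʳ {eqℤ (proj₂ v) j} t)) v≤u))
    u∈obstructing : _ ∈ filterᵇ (obstructs P) (rightV P x)
    u∈obstructing = ∈-filter⁺ (T? ∘ obstructs P) u∈right obstructing

-- The rows spanned by a section

open Occurrences ℤ._≟_ using (count-==-Unique)

record Span (P : SAP) (k : ℕ) (x : ℤ) : Set where
  field
    heights : List ℤ
    heights-unique : Unique heights
    heights-length : length heights ≡ 2 * k
    heights-bonds : ∀ y → y ∈ heights → (x , y) ∈ hbonds P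
    bottom : ℤ
    rows : ℕ
    heights-within : All (λ y → bottom ℤ.≤ y × y ℤ.≤ bottom ℤ.+ + rows) heights
    rows-uncut : ∀ j → bottom ℤ.≤ j → j ℤ.< bottom ℤ.+ + rows → T (uncut P x j)

m+[n-m]≡n : (m n : ℤ) → m ℤ.+ (n ℤ.- m) ≡ n
m+[n-m]≡n m n = begin
  m ℤ.+ (n ℤ.- m)       ≡⟨ cong (ℤ._+_ m) (ℤ.+-comm n (ℤ.- m)) ⟩
  m ℤ.+ (ℤ.- m ℤ.+ n)   ≡⟨ ℤ.+-assoc m (ℤ.- m) n ⟨
  (m ℤ.- m) ℤ.+ n       ≡⟨ cong (ℤ._+ n) (ℤ.+-inverseʳ m) ⟩
  + 0 ℤ.+ n             ≡⟨ ℤ.+-identityˡ n ⟩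
  n                     ∎
  where open ≡-Reasoning

-- The lowest and highest bond of the section lie on its page together with y0, so every row
-- between them is uncut.
KSection⇒Span : {P : SAP} {k : ℕ} {x y0 : ℤ} → KSection P k x y0 → Span P k x
KSection⇒Span {P} {k} {x} {y0} (_ , [] , unique , len , members) = record
  { heights = [] ; heights-unique = unique ; heights-length = len ; heights-bonds = λ _ ()
  ; bottom = y0 ; rows = 0 ; heights-within = []
  ; rows-uncut = λ j y0≤j j<y0 → ⊥-elim (ℤ.<-irrefl refl (ℤ.≤-<-trans y0≤j (subst (j ℤ.<_) (ℤ.+-identityʳ y0) j<y0)))
  }
KSection⇒Span {P} {k} {x} {y0} (_ , y₁ ∷ ys , unique , len , members) = record
  { heights = y₁ ∷ ys ; heights-unique = unique ; heights-length = len
  ; heights-bonds = λ y y∈ → proj₁ (Equivalence.to (members y) y∈)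
  ; bottom = m ; rows = ℤ.∣ M ℤ.- m ∣
  ; heights-within = All.zipWith (λ (m≤y , y≤M) → m≤y , subst (_ ℤ.≤_) (sym m+rows≡M) y≤M) (m≤ , ≤M)
  ; rows-uncut = uncut-between
  }
  where
    m M : ℤ
    m = Extrema.min y₁ ys
    M = Extrema.max y₁ ys
    m≤ : All (m ℤ.≤_) (y₁ ∷ ys)
    m≤ = Extrema.min≤⊤ y₁ ys ∷ Extrema.min≤xs y₁ ys
    ≤M : All (ℤ._≤ M) (y₁ ∷ ys)
    ≤M = Extrema.⊥≤max y₁ ys ∷ Extrema.xs≤max y₁ ys
    m∈ : m ∈ y₁ ∷ ys
    m∈ = Extrema.argmin-all id (here refl) (All.tabulate there)
    M∈ : M ∈ y₁ ∷ ys
    M∈ = Extrema.argmax-all id (here refl) (All.tabulate there)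
    m+rows≡M : m ℤ.+ + ℤ.∣ M ℤ.- m ∣ ≡ M
    m+rows≡M = trans (cong (ℤ._+_ m) (ℤ.0≤i⇒+∣i∣≡i (ℤ.i≤j⇒0≤j-i (All.lookup m≤ M∈)))) (m+[n-m]≡n m M)
    samePage : ∀ {y} → y ∈ y₁ ∷ ys → SamePage P x y0 y
    samePage {y} y∈ = proj₂ (Equivalence.to (members y) y∈)
    uncut-between : ∀ j → m ℤ.≤ j → j ℤ.< m ℤ.+ + ℤ.∣ M ℤ.- m ∣ → T (uncut P x j)
    uncut-between j m≤j j<end with j ℤ.<? y0
    ... | yes j<y0 = samePage m∈ j (ℤ.≤-trans (ℤ.i⊓j≤j y0 m) m≤j) (ℤ.<-≤-trans j<y0 (ℤ.i≤i⊔j y0 m))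
    ... | no j≮y0 = samePage M∈ j (ℤ.≤-trans (ℤ.i⊓j≤i y0 M) (ℤ.≮⇒≥ j≮y0))
                      (ℤ.<-≤-trans (subst (j ℤ.<_) m+rows≡M j<end) (ℤ.i≤j⊔i y0 M))

module _ {P : SAP} {k : ℕ} {x : ℤ} (span : Span P k x) where

  open Span span

  private
    marks : ℤ → ℕ
    marks j = count (λ y → eqℤ y j) heights

    marks≤1 : ∀ j → marks j ≤ 1
    marks≤1 j = count-==-Unique j heights-unique

    marks-total : rangeSum bottom (suc rows) marks ≡ 2 * k
    marks-total =
      trans (rangeSum-count≡length id bottom (suc rows) heights (All.map below-top heights-within)) heights-length
      where
        below-top : ∀ {y} → bottom ℤ.≤ y × y ℤ.≤ bottom ℤ.+ + rows → bottom ℤ.≤ y × y ℤ.< bottom ℤ.+ + suc rows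
        below-top {y} (bottom≤y , y≤top) =
          bottom≤y , subst (y ℤ.<_) (sym (+[1+n]≡+n+1 bottom rows)) (ℤ.≤-<-trans y≤top (i<i+1 _))

  span-side-bound : (side : ℤ → Bool) (side-flips : ∀ h → side h xor side (h ℤ.+ 1ℤ) ≡ eqℤ h x) →
    (∀ j → bottom ℤ.≤ j → j ℤ.< bottom ℤ.+ + rows → T (Side.blockedOn P x side side-flips j)) →
    3 * k ∸ 2 ≤ length (Side.sideV P x side side-flips)
  span-side-bound side side-flips blocked = begin
    3 * k ∸ 2
      ≤⟨ 3k∸2≤rangeSum rowCount marks bottom rows k marks≤1 marks-total positive change ⟩
    rangeSum bottom rows rowCount
      ≤⟨ rangeSum-count≤length proj₂ bottom rows sideV ⟩
    length sideV ∎
    where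
      open ≤-Reasoning
      open Side P x side side-flips
      positive : ∀ j → bottom ℤ.≤ j → j ℤ.< bottom ℤ.+ + rows → 1 ≤ rowCount j
      positive j bottom≤j j<top = 1≤rowCount j (blocked j bottom≤j j<top)
      change : ∀ j → bottom ℤ.≤ j → j ℤ.+ 1ℤ ℤ.< bottom ℤ.+ + rows → 1 ≤ marks (j ℤ.+ 1ℤ) →
               odd (rowCount j) xor odd (rowCount (j ℤ.+ 1ℤ)) ≡ true
      change j _ _ marked with 1≤count⇒∈ _ heights marked
      ... | y , y∈ , y-is-j+1 =
        rowCount-parity-flip j (subst (λ y → (x , y) ∈ hbonds P) (eqℤ-sound y-is-j+1) (heights-bonds y y∈))

  span-row-bound : (V : List Point) →
    (∀ j → bottom ℤ.≤ j → j ℤ.< bottom ℤ.+ + rows → 1 ≤ count (λ v → eqℤ (proj₂ v) j) V) →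
    2 * k ∸ 1 ≤ length V
  span-row-bound V hit = begin
    2 * k ∸ 1
      ≤⟨ ∸-monoˡ-≤ 1 (subst (_≤ suc rows) marks-total (rangeSum≤n bottom (suc rows) marks marks≤1)) ⟩
    rows
      ≡⟨ rangeSum-one bottom rows ⟨
    rangeSum bottom rows (λ _ → 1)
      ≤⟨ rangeSum-mono bottom rows _ _ hit ⟩
    rangeSum bottom rows (λ j → count (λ v → eqℤ (proj₂ v) j) V)
      ≤⟨ rangeSum-count≤length proj₂ bottom rows V ⟩
    length V ∎
    where open ≤-Reasoning

  span-column-bound : 2 * k ≤ length (filterᵇ (λ h → eqℤ (proj₁ h) x) (hbonds P))
  span-column-bound = begin
    2 * k
      ≡⟨ marks-total ⟨
    rangeSum bottom (suc rows) marks
      ≤⟨ rangeSum-mono bottom (suc rows) marks _ (λ j _ _ → marks≤bonds j) ⟩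
    rangeSum bottom (suc rows) (λ j → count (λ h → eqℤ (proj₂ h) j) column)
      ≤⟨ rangeSum-count≤length proj₂ bottom (suc rows) column ⟩
    length column ∎
    where
      open ≤-Reasoning
      column : List Point
      column = filterᵇ (λ h → eqℤ (proj₁ h) x) (hbonds P)
      marked-bond : ∀ j → 1 ≤ marks j → 1 ≤ count (λ h → eqℤ (proj₂ h) j) column
      marked-bond j marked with 1≤count⇒∈ _ heights marked
      ... | y , y∈ , y-is-j = ∈⇒1≤count _
        (∈-filter⁺ (T? ∘ λ h → eqℤ (proj₁ h) x) (heights-bonds y y∈) (T-eqℤ-refl x)) y-is-j
      marks≤bonds : ∀ j → marks j ≤ count (λ h → eqℤ (proj₂ h) j) column
      marks≤bonds j with marks j | marks≤1 j | marked-bond j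
      ... | zero | _ | _ = z≤n
      ... | suc zero | _ | bond = bond (s≤s z≤n)
      ... | suc (suc _) | s≤s () | _

-- Lower bounds

≤ᵇ-true : {a b : ℤ} → a ℤ.≤ b → (a ≤ᵇ b) ≡ true
≤ᵇ-true a≤b = Equivalence.to T-≡ (ℤ.≤⇒≤ᵇ a≤b)

≤ᵇ-false : {a b : ℤ} → b ℤ.< a → (a ≤ᵇ b) ≡ false
≤ᵇ-false {a} {b} b<a with a ≤ᵇ b in eq
... | true = ⊥-elim (ℤ.<⇒≱ b<a (ℤ.≤ᵇ⇒≤ (subst T (sym eq) tt)))
... | false = refl

left-flips : (x h : ℤ) → (h ≤ᵇ x) xor ((h ℤ.+ 1ℤ) ≤ᵇ x) ≡ eqℤ h x
left-flips x h with ℤ.<-cmp h x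
... | tri< h<x _ _
  rewrite ≤ᵇ-true (ℤ.<⇒≤ h<x) | ≤ᵇ-true (<⇒+1≤ h<x) | eqℤ-≢ (λ h≡x → ℤ.<-irrefl h≡x h<x) = refl
... | tri≈ _ refl _ rewrite ≤ᵇ-true (ℤ.≤-refl {h}) | ≤ᵇ-false (i<i+1 h) | eqℤ-refl h = refl
... | tri> _ _ x<h
  rewrite ≤ᵇ-false x<h | ≤ᵇ-false (ℤ.<-trans x<h (i<i+1 h)) | eqℤ-≢ (λ h≡x → ℤ.<-irrefl (sym h≡x) x<h) = refl

right-flips : (x h : ℤ) → ((x ℤ.+ 1ℤ) ≤ᵇ h) xor ((x ℤ.+ 1ℤ) ≤ᵇ (h ℤ.+ 1ℤ)) ≡ eqℤ h x
right-flips x h with ℤ.<-cmp h x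
... | tri< h<x _ _
  rewrite ≤ᵇ-false (ℤ.<-trans h<x (i<i+1 x)) | ≤ᵇ-false {x ℤ.+ 1ℤ} {h ℤ.+ 1ℤ} (ℤ.+-monoˡ-< 1ℤ h<x)
        | eqℤ-≢ (λ h≡x → ℤ.<-irrefl h≡x h<x) = refl
... | tri≈ _ refl _ rewrite ≤ᵇ-false (i<i+1 h) | ≤ᵇ-true (ℤ.≤-refl {h ℤ.+ 1ℤ}) | eqℤ-refl h = refl
... | tri> _ _ x<h
  rewrite ≤ᵇ-true (<⇒+1≤ x<h) | ≤ᵇ-true {x ℤ.+ 1ℤ} {h ℤ.+ 1ℤ} (ℤ.<⇒≤ (ℤ.+-monoˡ-< 1ℤ x<h))
        | eqℤ-≢ (λ h≡x → ℤ.<-irrefl (sym h≡x) x<h) = refl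

section-bounds : (k : ℕ) (P : SAP) (x y0 : ℤ) → KSection P k x y0 →
  (3 * k ∸ 2 ≤ length (leftV P x) × 2 * k ∸ 1 ≤ length (filterᵇ (obstructs P) (leftV P x))) ×
  (3 * k ∸ 2 ≤ length (rightV P x) × 2 * k ∸ 1 ≤ length (filterᵇ (obstructs P) (rightV P x)))
section-bounds k P x y0 section =
  ( span-side-bound span (_≤ᵇ x) (left-flips x) blocked-left
  , span-row-bound span (filterᵇ (obstructs P) (leftV P x)) (λ j l u → obstructing-left P x j (blocked-left j l u)) ) ,
  ( span-side-bound span ((x ℤ.+ 1ℤ) ≤ᵇ_) (right-flips x) blocked-right
  , span-row-bound span (filterᵇ (obstructs P) (rightV P x)) (λ j l u → obstructing-right P x j (blocked-right j l u)) )
  where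
    span : Span P k x
    span = KSection⇒Span {P} {k} {x} {y0} section
    open Span span using (bottom; rows; rows-uncut)
    blocked-left : ∀ j → bottom ℤ.≤ j → j ℤ.< bottom ℤ.+ + rows → T (blockedLeftBy P x j)
    blocked-left j l u = T-∧⁻ˡ (rows-uncut j l u)
    blocked-right : ∀ j → bottom ℤ.≤ j → j ℤ.< bottom ℤ.+ + rows → T (blockedRightBy P x j)
    blocked-right j l u = T-∧⁻ʳ {blockedLeftBy P x j} (rows-uncut j l u)

length-leftV+rightV≤ : (P : SAP) (x : ℤ) → length (leftV P x) + length (rightV P x) ≤ length (vbonds P)
length-leftV+rightV≤ P x = begin
  length (leftV P x) + length (rightV P x)
    ≡⟨ cong₂ _+_ (length-filterᵇ left (vbonds P)) (length-filterᵇ right (vbonds P)) ⟩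
  count left (vbonds P) + count right (vbonds P)
    ≡⟨ count-∨-disjoint left right (vbonds P) disjoint ⟨
  count (λ v → left v ∨ right v) (vbonds P)
    ≤⟨ count≤length _ (vbonds P) ⟩
  length (vbonds P) ∎
  where
    open ≤-Reasoning
    left right : Point → Bool
    left v = proj₁ v ≤ᵇ x
    right v = (x ℤ.+ 1ℤ) ≤ᵇ proj₁ v
    disjoint : ∀ v → T (left v) → T (right v) → ⊥
    disjoint v l r = ℤ.<-irrefl refl (ℤ.<-≤-trans (+1≤⇒< (ℤ.≤ᵇ⇒≤ {x ℤ.+ 1ℤ} r)) (ℤ.≤ᵇ⇒≤ l))

double-3k∸2 : ∀ k → (3 * k ∸ 2) + (3 * k ∸ 2) ≡ 6 * k ∸ 4
double-3k∸2 zero = refl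
double-3k∸2 (suc k) = begin
  (3 * suc k ∸ 2) + (3 * suc k ∸ 2)  ≡⟨ cong (λ t → (t ∸ 2) + (t ∸ 2)) (*-suc 3 k) ⟩
  suc (3 * k) + suc (3 * k)          ≡⟨ solve 1 (λ k → (con 1 :+ con 3 :* k) :+ (con 1 :+ con 3 :* k)
                                                  := con 2 :+ con 6 :* k) refl k ⟩
  2 + 6 * k                          ≡⟨ cong (_∸ 4) (*-suc 6 k) ⟨
  6 * suc k ∸ 4                      ∎
  where
    open ≡-Reasoning
    open +-*-Solver

no-small-section : (k : ℕ) (P : SAP) → length (vbonds P) < 6 * k ∸ 4 → (x y0 : ℤ) → ¬ KSection P k x y0
no-small-section k P small x y0 section = <⇒≱ small (begin
  6 * k ∸ 4                                 ≡⟨ double-3k∸2 k ⟨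
  (3 * k ∸ 2) + (3 * k ∸ 2)                 ≤⟨ +-mono-≤ (proj₁ (proj₁ bounds)) (proj₁ (proj₂ bounds)) ⟩
  length (leftV P x) + length (rightV P x)  ≤⟨ length-leftV+rightV≤ P x ⟩
  length (vbonds P)                         ∎)
  where
    open ≤-Reasoning
    bounds : (3 * k ∸ 2 ≤ length (leftV P x) × _) × (3 * k ∸ 2 ≤ length (rightV P x) × _)
    bounds = section-bounds k P x y0 section

Walk : {A : Set} → A → List (A × A) → A → Set
Walk s [] t = s ≡ t
Walk s (e ∷ es) t = proj₁ e ≡ s × Walk (proj₂ e) es t

module _ {A : Set} where

  walk-++ : {s t u : A} (es fs : List (A × A)) → Walk s es t → Walk t fs u → Walk s (es ++ fs) u
  walk-++ [] fs refl walk = walk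
  walk-++ (e ∷ es) fs (start , walk) walk′ = start , walk-++ es fs walk walk′

  walk-endpoints : {s s′ t t′ : A} (es : List (A × A)) → s ≡ s′ → t ≡ t′ → Walk s es t → Walk s′ es t′
  walk-endpoints es refl refl walk = walk

  targets≡sources : {t u : A} (es : List (A × A)) → Walk t es u → t ∷ map proj₂ es ≡ map proj₁ es ++ [ u ]
  targets≡sources [] refl = refl
  targets≡sources (e ∷ es) (refl , walk) = cong (proj₁ e ∷_) (targets≡sources es walk)

  zip-proj : (es : List (A × A)) → zip (map proj₁ es) (map proj₂ es) ≡ es
  zip-proj [] = refl
  zip-proj (e ∷ es) = cong (e ∷_) (zip-proj es)

  cyclicPairs-closed-walk : {s : A} (es : List (A × A)) → Walk s es s → cyclicPairs (map proj₁ es) ≡ es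
  cyclicPairs-closed-walk [] _ = refl
  cyclicPairs-closed-walk (e ∷ es) (refl , walk) =
    trans (cong (zip (map proj₁ (e ∷ es))) (sym (targets≡sources es walk))) (zip-proj (e ∷ es))

  Unique-unrotate : (v : A) (ws : List A) → Unique (ws ++ [ v ]) → Unique (v ∷ ws)
  Unique-unrotate v [] _ = [] ∷ []
  Unique-unrotate v (w ∷ ws) (w∉ ∷ uniq) with All.++⁻ ws w∉ | Unique-unrotate v ws uniq
  ... | w∉ws , w≢v ∷ [] | v∉ws ∷ uniq′ = ((w≢v ∘ sym) ∷ v∉ws) ∷ w∉ws ∷ uniq′

  sources⊆targets : {s p : A} (es : List (A × A)) → Walk s es s → p ∈ map proj₁ es → p ∈ map proj₂ es
  sources⊆targets (e ∷ es) (refl , walk) p∈ = subst (_ ∈_) (sym (targets≡sources es walk)) (rotated p∈)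
    where
      rotated : ∀ {p} → p ∈ proj₁ e ∷ map proj₁ es → p ∈ map proj₁ es ++ [ proj₁ e ]
      rotated (here refl) = ∈-++⁺ʳ (map proj₁ es) (here refl)
      rotated (there p∈es) = ∈-++⁺ˡ p∈es

  Unique-sources-closed-walk : {s : A} (es : List (A × A)) → Walk s es s →
    Unique (map proj₂ es) → Unique (map proj₁ es)
  Unique-sources-closed-walk [] _ _ = []
  Unique-sources-closed-walk (e ∷ es) (refl , walk) uniq =
    Unique-unrotate (proj₁ e) (map proj₁ es) (subst Unique (targets≡sources es walk) uniq)

Site : Set
Site = ℕ × ℕ

Move : Set
Move = Site × Site

toPoint : Site → Point
toPoint (a , b) = (+ a , + b)

toStep : Move → Point × Point
toStep (p , q) = (toPoint p , toPoint q)

Adjacent : Move → Set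
Adjacent e = Adj (toPoint (proj₁ e)) (toPoint (proj₂ e))

vertical : Move → Bool
vertical e = isVertStep (toStep e)

horizontalAt : ℤ → Move → Bool
horizontalAt c e = not (vertical e) ∧ eqℤ (proj₁ (hpos (toStep e))) c

targets : List Move → List Site
targets = map proj₂

toPoint-injective : {p q : Site} → toPoint p ≡ toPoint q → p ≡ q
toPoint-injective {a , b} {c , d} eq = cong₂ _,_ (ℤ.+-injective (cong proj₁ eq)) (ℤ.+-injective (cong proj₂ eq))

walk-toStep : {s t : Site} (es : List Move) → Walk s es t → Walk (toPoint s) (map toStep es) (toPoint t)
walk-toStep [] refl = refl
walk-toStep (e ∷ es) (refl , walk) = refl , walk-toStep es walk

-- Distinctness is checked on the targets of the moves: for the comb these fall into disjoint bands of rows.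
module ClosedWalk (es : List Move) {s : Site} (closed-walk : Walk s es s) (adjacent : All Adjacent es)
                  (targets-unique : Unique (targets es)) (long-walk : 4 ≤ length es) where

  closed-steps : cyclicPairs (map proj₁ (map toStep es)) ≡ map toStep es
  closed-steps = cyclicPairs-closed-walk (map toStep es) (walk-toStep es closed-walk)

  polygon : SAP
  polygon = record
    { verts = map proj₁ (map toStep es)
    ; long = subst (4 ≤_) (sym (trans (length-map proj₁ (map toStep es)) (length-map toStep es))) long-walk
    ; distinct = Unique-sources-closed-walk (map toStep es) (walk-toStep es closed-walk)
                   (subst Unique (trans (sym (map-∘ es)) (map-∘ es)) (Unique.map⁺ toPoint-injective targets-unique))
    ; closed = subst (All (λ pq → Adj (proj₁ pq) (proj₂ pq))) (sym closed-steps) (All.map⁺ adjacent)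
    }

  length-vbonds : length (vbonds polygon) ≡ count vertical es
  length-vbonds = begin
    length (map vpos (filterᵇ isVertStep (steps polygon)))  ≡⟨ length-map vpos (filterᵇ isVertStep (steps polygon)) ⟩
    length (filterᵇ isVertStep (steps polygon))             ≡⟨ length-filterᵇ isVertStep (steps polygon) ⟩
    count isVertStep (steps polygon)                        ≡⟨ cong (count isVertStep) closed-steps ⟩
    count isVertStep (map toStep es)                        ≡⟨ count-map isVertStep toStep es ⟩
    count vertical es                                       ∎
    where open ≡-Reasoning

  count-column : (c : ℤ) → count (λ h → eqℤ (proj₁ h) c) (hbonds polygon) ≡ count (horizontalAt c) es
  count-column c = begin
    count column (map hpos (filterᵇ (not ∘ isVertStep) (steps polygon)))
      ≡⟨ count-map column hpos (filterᵇ (not ∘ isVertStep) (steps polygon)) ⟩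
    count (column ∘ hpos) (filterᵇ (not ∘ isVertStep) (steps polygon))
      ≡⟨ count-filterᵇ (column ∘ hpos) (not ∘ isVertStep) (steps polygon) ⟩
    count (λ e → not (isVertStep e) ∧ column (hpos e)) (steps polygon)
      ≡⟨ cong (count (λ e → not (isVertStep e) ∧ column (hpos e))) closed-steps ⟩
    count (λ e → not (isVertStep e) ∧ column (hpos e)) (map toStep es)
      ≡⟨ count-map _ toStep es ⟩
    count (horizontalAt c) es ∎
    where
      open ≡-Reasoning
      column : Point → Bool
      column h = eqℤ (proj₁ h) c

  step∈ : {e : Move} → e ∈ es → toStep e ∈ steps polygon
  step∈ {e} e∈ = subst (toStep e ∈_) (sym closed-steps) (∈-map⁺ toStep e∈)

  ∈-hbonds : {e : Move} → e ∈ es → vertical e ≡ false → hpos (toStep e) ∈ hbonds polygon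
  ∈-hbonds e∈ horizontal =
    ∈-map⁺ hpos (∈-filter⁺ (T? ∘ not ∘ isVertStep) (step∈ e∈) (subst (T ∘ not) (sym horizontal) tt))

  ∈-vbonds : {e : Move} → e ∈ es → vertical e ≡ true → vpos (toStep e) ∈ vbonds polygon
  ∈-vbonds e∈ vert = ∈-map⁺ vpos (∈-filter⁺ (T? ∘ isVertStep) (step∈ e∈) (subst T (sym vert) tt))

  hbonds⁻ : {h : Point} → h ∈ hbonds polygon → ∃ λ e → e ∈ es × h ≡ hpos (toStep e)
  hbonds⁻ h∈ with ∈-map⁻ hpos h∈
  ... | f , f∈ , refl with ∈-filter⁻ (T? ∘ not ∘ isVertStep) f∈
  ... | f∈steps , _ with ∈-map⁻ toStep (subst (_ ∈_) closed-steps f∈steps)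
  ... | e , e∈ , refl = e , e∈ , refl

-- east and north start at (a , b); west and south end there.
east west north south : ℕ → ℕ → ℕ → List Move
east a b zero = []
east a b (suc n) = ((a , b) , (suc a , b)) ∷ east (suc a) b n
west a b zero = []
west a b (suc n) = ((suc (n + a) , b) , (n + a , b)) ∷ west a b n
north a b zero = []
north a b (suc n) = ((a , b) , (a , suc b)) ∷ north a (suc b) n
south a b zero = []
south a b (suc n) = ((a , suc (n + b)) , (a , n + b)) ∷ south a b n

walk-east : (a b n : ℕ) → Walk (a , b) (east a b n) (n + a , b)
walk-east a b zero = refl
walk-east a b (suc n) = refl , walk-endpoints (east (suc a) b n) refl (cong (_, b) (+-suc n a)) (walk-east (suc a) b n)

walk-west : (a b n : ℕ) → Walk (n + a , b) (west a b n) (a , b)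
walk-west a b zero = refl
walk-west a b (suc n) = refl , walk-west a b n

walk-north : (a b n : ℕ) → Walk (a , b) (north a b n) (a , n + b)
walk-north a b zero = refl
walk-north a b (suc n) = refl , walk-endpoints (north a (suc b) n) refl (cong (a ,_) (+-suc n b)) (walk-north a (suc b) n)

walk-south : (a b n : ℕ) → Walk (a , n + b) (south a b n) (a , b)
walk-south a b zero = refl
walk-south a b (suc n) = refl , walk-south a b n

last∈west : (a b n : ℕ) → ((suc a , b) , (a , b)) ∈ west a b (suc n)
last∈west a b zero = here refl
last∈west a b (suc n) = there (last∈west a b n)

∈-north : (a b n j : ℕ) → j < n → ((a , j + b) , (a , suc (j + b))) ∈ north a b n
∈-north a b (suc n) zero _ = here refl
∈-north a b (suc n) (suc j) (s≤s j<n) =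
  there (subst (λ t → ((a , t) , (a , suc t)) ∈ north a (suc b) n) (+-suc j b) (∈-north a (suc b) n j j<n))

+[1+a]≡+a+1 : (a : ℕ) → + suc a ≡ + a ℤ.+ 1ℤ
+[1+a]≡+a+1 a = cong +_ (+-comm 1 a)

adjacent-east : (a b n : ℕ) → All Adjacent (east a b n)
adjacent-east a b zero = []
adjacent-east a b (suc n) = inj₁ (+[1+a]≡+a+1 a , refl) ∷ adjacent-east (suc a) b n

adjacent-west : (a b n : ℕ) → All Adjacent (west a b n)
adjacent-west a b zero = []
adjacent-west a b (suc n) = inj₂ (inj₁ (+[1+a]≡+a+1 (n + a) , refl)) ∷ adjacent-west a b n

adjacent-north : (a b n : ℕ) → All Adjacent (north a b n)
adjacent-north a b zero = []
adjacent-north a b (suc n) = inj₂ (inj₂ (inj₁ (refl , +[1+a]≡+a+1 b))) ∷ adjacent-north a (suc b) n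

adjacent-south : (a b n : ℕ) → All Adjacent (south a b n)
adjacent-south a b zero = []
adjacent-south a b (suc n) = inj₂ (inj₂ (inj₂ (refl , +[1+a]≡+a+1 (n + b)))) ∷ adjacent-south a b n

eqℤ-+a-+[1+a] : (a : ℕ) → eqℤ (+ a) (+ suc a) ≡ false
eqℤ-+a-+[1+a] a = eqℤ-≢ (λ eq → 1+n≢n {a} (sym (ℤ.+-injective eq)))

eqℤ-+[1+a]-+a : (a : ℕ) → eqℤ (+ suc a) (+ a) ≡ false
eqℤ-+[1+a]-+a a = eqℤ-≢ (λ eq → 1+n≢n {a} (ℤ.+-injective eq))

count-vertical-east : (a b n : ℕ) → count vertical (east a b n) ≡ 0
count-vertical-east a b zero = refl
count-vertical-east a b (suc n) rewrite eqℤ-+a-+[1+a] a = count-vertical-east (suc a) b n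

count-vertical-west : (a b n : ℕ) → count vertical (west a b n) ≡ 0
count-vertical-west a b zero = refl
count-vertical-west a b (suc n) rewrite eqℤ-+[1+a]-+a (n + a) = count-vertical-west a b n

count-vertical-north : (a b n : ℕ) → count vertical (north a b n) ≡ n
count-vertical-north a b zero = refl
count-vertical-north a b (suc n) rewrite eqℤ-refl (+ a) = cong suc (count-vertical-north a (suc b) n)

count-vertical-south : (a b n : ℕ) → count vertical (south a b n) ≡ n
count-vertical-south a b zero = refl
count-vertical-south a b (suc n) rewrite eqℤ-refl (+ a) = cong suc (count-vertical-south a b n)

count-horizontalAt-north : (c : ℤ) (a b n : ℕ) → count (horizontalAt c) (north a b n) ≡ 0
count-horizontalAt-north c a b zero = refl
count-horizontalAt-north c a b (suc n) rewrite eqℤ-refl (+ a) = count-horizontalAt-north c a (suc b) n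

count-horizontalAt-south : (c : ℤ) (a b n : ℕ) → count (horizontalAt c) (south a b n) ≡ 0
count-horizontalAt-south c a b zero = refl
count-horizontalAt-south c a b (suc n) rewrite eqℤ-refl (+ a) = count-horizontalAt-south c a b n

Avoids : ℤ → ℕ → ℕ → Set
Avoids c lo hi = ∀ m → lo ≤ m → m < hi → c ≢ + m

count-horizontalAt-east-outside : (c : ℤ) (a b n : ℕ) → Avoids c a (n + a) →
  count (horizontalAt c) (east a b n) ≡ 0
count-horizontalAt-east-outside c a b zero _ = refl
count-horizontalAt-east-outside c a b (suc n) avoids
  rewrite eqℤ-+a-+[1+a] a | m≤n⇒m⊓n≡m (n≤1+n a) | eqℤ-≢ (λ a≡c → avoids a ≤-refl (s≤s (m≤n+m a n)) (sym a≡c)) =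
    count-horizontalAt-east-outside c (suc a) b n (λ m a<m m<end → avoids m (<⇒≤ a<m) (subst (m <_) (+-suc n a) m<end))

count-horizontalAt-east≤1 : (c : ℤ) (a b n : ℕ) → count (horizontalAt c) (east a b n) ≤ 1
count-horizontalAt-east≤1 c a b zero = z≤n
count-horizontalAt-east≤1 c a b (suc n) rewrite eqℤ-+a-+[1+a] a | m≤n⇒m⊓n≡m (n≤1+n a) with + a ℤ.≟ c
... | yes refl = s≤s (≤-reflexive (count-horizontalAt-east-outside (+ a) (suc a) b n
                   (λ m a<m _ eq → <-irrefl (ℤ.+-injective eq) a<m)))
... | no _ = count-horizontalAt-east≤1 c (suc a) b n

count-horizontalAt-west-outside : (c : ℤ) (a b n : ℕ) → Avoids c a (n + a) →
  count (horizontalAt c) (west a b n) ≡ 0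
count-horizontalAt-west-outside c a b zero _ = refl
count-horizontalAt-west-outside c a b (suc n) avoids
  rewrite eqℤ-+[1+a]-+a (n + a) | m≥n⇒m⊓n≡n (n≤1+n (n + a))
        | eqℤ-≢ (λ eq → avoids (n + a) (m≤n+m a n) ≤-refl (sym eq)) =
    count-horizontalAt-west-outside c a b n (λ m a≤m m<end → avoids m a≤m (m<n⇒m<1+n m<end))

count-horizontalAt-west≤1 : (c : ℤ) (a b n : ℕ) → count (horizontalAt c) (west a b n) ≤ 1
count-horizontalAt-west≤1 c a b zero = z≤n
count-horizontalAt-west≤1 c a b (suc n) rewrite eqℤ-+[1+a]-+a (n + a) | m≥n⇒m⊓n≡n (n≤1+n (n + a)) with + (n + a) ℤ.≟ c
... | yes refl = s≤s (≤-reflexive (count-horizontalAt-west-outside (+ (n + a)) a b n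
                   (λ m _ m<end eq → <-irrefl (sym (ℤ.+-injective eq)) m<end)))
... | no _ = count-horizontalAt-west≤1 c a b n

InBox : ℕ → ℕ → ℕ → ℕ → Site → Set
InBox x₀ x₁ y₀ y₁ p = x₀ ≤ proj₁ p × proj₁ p < x₁ × y₀ ≤ proj₂ p × proj₂ p < y₁

TargetsIn : ℕ → ℕ → ℕ → ℕ → List Move → Set
TargetsIn x₀ x₁ y₀ y₁ = All (InBox x₀ x₁ y₀ y₁ ∘ proj₂)

box-weaken : {x₀ x₁ y₀ y₁ x₀′ x₁′ y₀′ y₁′ : ℕ} {es : List Move} →
  x₀′ ≤ x₀ → x₁ ≤ x₁′ → y₀′ ≤ y₀ → y₁ ≤ y₁′ →
  TargetsIn x₀ x₁ y₀ y₁ es → TargetsIn x₀′ x₁′ y₀′ y₁′ es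
box-weaken lx ux ly uy = All.map λ (x₀≤ , <x₁ , y₀≤ , <y₁) →
  ≤-trans lx x₀≤ , <-≤-trans <x₁ ux , ≤-trans ly y₀≤ , <-≤-trans <y₁ uy

box-east : (a b n : ℕ) → TargetsIn (suc a) (suc (n + a)) b (suc b) (east a b n)
box-east a b zero = []
box-east a b (suc n) = (≤-refl , s≤s (s≤s (m≤n+m a n)) , ≤-refl , ≤-refl) ∷
  box-weaken (n≤1+n _) (≤-reflexive (cong suc (+-suc n a))) ≤-refl ≤-refl (box-east (suc a) b n)

box-west : (a b n : ℕ) → TargetsIn a (n + a) b (suc b) (west a b n)
box-west a b zero = []
box-west a b (suc n) = (m≤n+m a n , ≤-refl , ≤-refl , ≤-refl) ∷
  box-weaken ≤-refl (n≤1+n _) ≤-refl ≤-refl (box-west a b n)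

box-north : (a b n : ℕ) → TargetsIn a (suc a) (suc b) (suc (n + b)) (north a b n)
box-north a b zero = []
box-north a b (suc n) = (≤-refl , ≤-refl , ≤-refl , s≤s (s≤s (m≤n+m b n))) ∷
  box-weaken ≤-refl ≤-refl (n≤1+n _) (≤-reflexive (cong suc (+-suc n b))) (box-north a (suc b) n)

box-south : (a b n : ℕ) → TargetsIn a (suc a) b (n + b) (south a b n)
box-south a b zero = []
box-south a b (suc n) = (≤-refl , ≤-refl , m≤n+m b n , ≤-refl) ∷
  box-weaken ≤-refl ≤-refl ≤-refl (n≤1+n _) (box-south a b n)

∉-box : {p : Site} {Q : Site → Set} {es : List Move} → (∀ {r} → Q r → p ≢ r) → All (Q ∘ proj₂) es →
  All (p ≢_) (targets es)
∉-box p∉Q boxed = All.map⁺ (All.map p∉Q boxed)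

unique-east : (a b n : ℕ) → Unique (targets (east a b n))
unique-east a b zero = []
unique-east a b (suc n) =
  ∉-box (λ (a<x , _) eq → <-irrefl (cong proj₁ eq) a<x) (box-east (suc a) b n) ∷ unique-east (suc a) b n

unique-west : (a b n : ℕ) → Unique (targets (west a b n))
unique-west a b zero = []
unique-west a b (suc n) =
  ∉-box (λ (_ , x<n+a , _) eq → <-irrefl (sym (cong proj₁ eq)) x<n+a) (box-west a b n) ∷ unique-west a b n

unique-north : (a b n : ℕ) → Unique (targets (north a b n))
unique-north a b zero = []
unique-north a b (suc n) =
  ∉-box (λ (_ , _ , b<y , _) eq → <-irrefl (cong proj₂ eq) b<y) (box-north a (suc b) n) ∷ unique-north a (suc b) n

unique-south : (a b n : ℕ) → Unique (targets (south a b n))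
unique-south a b zero = []
unique-south a b (suc n) =
  ∉-box (λ (_ , _ , _ , y<n+b) eq → <-irrefl (sym (cong proj₂ eq)) y<n+b) (box-south a b n) ∷ unique-south a b n

Apart : (ℕ × ℕ × ℕ × ℕ) → (ℕ × ℕ × ℕ × ℕ) → Set
Apart (x₀ , x₁ , y₀ , y₁) (x₀′ , x₁′ , y₀′ , y₁′) = x₁ ≤ x₀′ ⊎ x₁′ ≤ x₀ ⊎ y₁ ≤ y₀′ ⊎ y₁′ ≤ y₀

apart-disjoint : {x₀ x₁ y₀ y₁ x₀′ x₁′ y₀′ y₁′ : ℕ} {xs ys : List Move} →
  TargetsIn x₀ x₁ y₀ y₁ xs → TargetsIn x₀′ x₁′ y₀′ y₁′ ys →
  Apart (x₀ , x₁ , y₀ , y₁) (x₀′ , x₁′ , y₀′ , y₁′) → Disjoint (targets xs) (targets ys)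
apart-disjoint boxed boxed′ apart (p∈xs , p∈ys) =
  separated (All.lookup (All.map⁺ boxed) p∈xs) (All.lookup (All.map⁺ boxed′) p∈ys) apart
  where
    separated : ∀ {x₀ x₁ y₀ y₁ x₀′ x₁′ y₀′ y₁′ p} → InBox x₀ x₁ y₀ y₁ p → InBox x₀′ x₁′ y₀′ y₁′ p →
                Apart (x₀ , x₁ , y₀ , y₁) (x₀′ , x₁′ , y₀′ , y₁′) → ⊥
    separated (_ , <x₁ , _ , _) (x₀′≤ , _ , _ , _) (inj₁ x₁≤x₀′) =
      <-irrefl refl (<-≤-trans <x₁ (≤-trans x₁≤x₀′ x₀′≤))
    separated (x₀≤ , _ , _ , _) (_ , <x₁′ , _ , _) (inj₂ (inj₁ x₁′≤x₀)) =
      <-irrefl refl (<-≤-trans <x₁′ (≤-trans x₁′≤x₀ x₀≤))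
    separated (_ , _ , _ , <y₁) (_ , _ , y₀′≤ , _) (inj₂ (inj₂ (inj₁ y₁≤y₀′))) =
      <-irrefl refl (<-≤-trans <y₁ (≤-trans y₁≤y₀′ y₀′≤))
    separated (_ , _ , y₀≤ , _) (_ , _ , _ , <y₁′) (inj₂ (inj₂ (inj₂ y₁′≤y₀))) =
      <-irrefl refl (<-≤-trans <y₁′ (≤-trans y₁′≤y₀ y₀≤))

module _ (xs ys : List Move) where

  targets-++ : targets (xs ++ ys) ≡ targets xs ++ targets ys
  targets-++ = map-++ proj₂ xs ys

  Unique-targets-++ : Unique (targets xs) → Unique (targets ys) → Disjoint (targets xs) (targets ys) →
    Unique (targets (xs ++ ys))
  Unique-targets-++ uxs uys disjoint = subst Unique (sym targets-++) (Unique.++⁺ uxs uys disjoint)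

  Disjoint-targets-++ : {zs : List Move} → Disjoint (targets zs) (targets xs) → Disjoint (targets zs) (targets ys) →
    Disjoint (targets zs) (targets (xs ++ ys))
  Disjoint-targets-++ dxs dys (p∈zs , p∈xs++ys) with ∈-++⁻ (targets xs) (subst (_ ∈_) targets-++ p∈xs++ys)
  ... | inj₁ p∈xs = dxs (p∈zs , p∈xs)
  ... | inj₂ p∈ys = dys (p∈zs , p∈ys)

-- The extremal polygons

double : ℕ → ℕ
double zero = zero
double (suc n) = suc (suc (double n))

double≡2* : (n : ℕ) → double n ≡ 2 * n
double≡2* zero = refl
double≡2* (suc n) = trans (cong (suc ∘ suc) (double≡2* n)) (sym (*-suc 2 n))

-- A tooth descends from (4 + q , 3 + q) to (2 + q , 1 + q): a notch in the right wall, then a loop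
-- reaching into column 1 at heights 2 + q and 1 + q.
notch loop tooth : ℕ → List Move
notch q = south (4 + q) (1 + q) 2 ++ west (3 + q) (1 + q) 1 ++ north (3 + q) (1 + q) 1
loop q = west 1 (2 + q) (2 + q) ++ south 1 (1 + q) 1 ++ east 1 (1 + q) (1 + q)
tooth q = notch q ++ loop q

teeth : ℕ → List Move
teeth zero = []
teeth (suc s) = tooth (double s) ++ teeth s

base : List Move
base = south 2 0 1 ++ west 0 0 2

-- comb K is the extremal polygon for k = K + 2: a left wall and a top row at height 2k − 1, K + 1
-- teeth and a base, so that column 1 carries one horizontal bond at each height 0, …, 2k − 1.
comb : ℕ → List Move
comb K = north 0 0 (3 + double K) ++ east 0 (3 + double K) (4 + double K) ++ teeth (suc K) ++ base

walk-tooth : (q : ℕ) → Walk (4 + q , 3 + q) (tooth q) (2 + q , 1 + q)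
walk-tooth q =
  walk-++ (notch q) (loop q)
    (walk-++ (south (4 + q) (1 + q) 2) _ (walk-south (4 + q) (1 + q) 2)
      (walk-++ (west (3 + q) (1 + q) 1) _ (walk-west (3 + q) (1 + q) 1) (walk-north (3 + q) (1 + q) 1)))
    (walk-++ (west 1 (2 + q) (2 + q)) _
      (walk-endpoints (west 1 (2 + q) (2 + q)) (cong (_, 2 + q) (+-comm (2 + q) 1)) refl (walk-west 1 (2 + q) (2 + q)))
      (walk-++ (south 1 (1 + q) 1) _ (walk-south 1 (1 + q) 1)
        (walk-endpoints (east 1 (1 + q) (1 + q)) refl (cong (_, 1 + q) (+-comm (1 + q) 1)) (walk-east 1 (1 + q) (1 + q)))))

walk-teeth : (s : ℕ) → Walk (2 + double s , 1 + double s) (teeth s) (2 , 1)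
walk-teeth zero = refl
walk-teeth (suc s) = walk-++ (tooth (double s)) (teeth s) (walk-tooth (double s)) (walk-teeth s)

walk-comb : (K : ℕ) → Walk (0 , 0) (comb K) (0 , 0)
walk-comb K =
  walk-++ (north 0 0 top) _
    (walk-endpoints (north 0 0 top) refl (cong (0 ,_) (+-identityʳ top)) (walk-north 0 0 top))
    (walk-++ (east 0 top (suc top)) _
      (walk-endpoints (east 0 top (suc top)) refl (cong (_, top) (+-identityʳ (suc top))) (walk-east 0 top (suc top)))
      (walk-++ (teeth (suc K)) base (walk-teeth (suc K))
        (walk-++ (south 2 0 1) (west 0 0 2) (walk-south 2 0 1) (walk-west 0 0 2))))
  where
    top : ℕ
    top = 3 + double K

adjacent-tooth : (q : ℕ) → All Adjacent (tooth q)
adjacent-tooth q =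
  All.++⁺ (All.++⁺ (adjacent-south (4 + q) (1 + q) 2) (All.++⁺ (adjacent-west (3 + q) (1 + q) 1) (adjacent-north (3 + q) (1 + q) 1)))
          (All.++⁺ (adjacent-west 1 (2 + q) (2 + q)) (All.++⁺ (adjacent-south 1 (1 + q) 1) (adjacent-east 1 (1 + q) (1 + q))))

adjacent-teeth : (s : ℕ) → All Adjacent (teeth s)
adjacent-teeth zero = []
adjacent-teeth (suc s) = All.++⁺ (adjacent-tooth (double s)) (adjacent-teeth s)

adjacent-comb : (K : ℕ) → All Adjacent (comb K)
adjacent-comb K =
  All.++⁺ (adjacent-north 0 0 (3 + double K)) (All.++⁺ (adjacent-east 0 (3 + double K) (4 + double K))
    (All.++⁺ (adjacent-teeth (suc K)) (All.++⁺ (adjacent-south 2 0 1) (adjacent-west 0 0 2))))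

count-++₃ : {A : Set} (p : A → Bool) (xs ys zs : List A) →
  count p (xs ++ ys ++ zs) ≡ count p xs + (count p ys + count p zs)
count-++₃ p xs ys zs = trans (count-++ p xs (ys ++ zs)) (cong (_+_ (count p xs)) (count-++ p ys zs))

count-vertical-tooth : (q : ℕ) → count vertical (tooth q) ≡ 4
count-vertical-tooth q =
  trans (count-++ vertical (south (4 + q) (1 + q) 2 ++ west (3 + q) (1 + q) 1 ++ north (3 + q) (1 + q) 1)
                           (west 1 (2 + q) (2 + q) ++ south 1 (1 + q) 1 ++ east 1 (1 + q) (1 + q)))
        (cong₂ _+_
          (trans (count-++₃ vertical (south (4 + q) (1 + q) 2) (west (3 + q) (1 + q) 1) (north (3 + q) (1 + q) 1))
                 (cong₂ _+_ (count-vertical-south (4 + q) (1 + q) 2)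
                            (cong₂ _+_ (count-vertical-west (3 + q) (1 + q) 1) (count-vertical-north (3 + q) (1 + q) 1))))
          (trans (count-++₃ vertical (west 1 (2 + q) (2 + q)) (south 1 (1 + q) 1) (east 1 (1 + q) (1 + q)))
                 (cong₂ _+_ (count-vertical-west 1 (2 + q) (2 + q))
                            (cong₂ _+_ (count-vertical-south 1 (1 + q) 1) (count-vertical-east 1 (1 + q) (1 + q))))))

count-vertical-teeth : (s : ℕ) → count vertical (teeth s) ≡ 4 * s
count-vertical-teeth zero = refl
count-vertical-teeth (suc s) =
  trans (count-++ vertical (tooth (double s)) (teeth s))
        (trans (cong₂ _+_ (count-vertical-tooth (double s)) (count-vertical-teeth s)) (sym (*-suc 4 s)))

count-vertical-comb : (K : ℕ) → count vertical (comb K) ≡ 6 * (2 + K) ∸ 4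
count-vertical-comb K = begin
  count vertical (comb K)
    ≡⟨ count-++₃ vertical (north 0 0 top) (east 0 top (suc top)) (teeth (suc K) ++ base) ⟩
  count vertical (north 0 0 top) + (count vertical (east 0 top (suc top)) + count vertical (teeth (suc K) ++ base))
    ≡⟨ cong₂ _+_ (count-vertical-north 0 0 top) (cong₂ _+_ (count-vertical-east 0 top (suc top)) rest) ⟩
  top + (0 + (4 * suc K + 1))
    ≡⟨ cong (λ t → 3 + t + (4 * suc K + 1)) (double≡2* K) ⟩
  3 + 2 * K + (4 * suc K + 1)
    ≡⟨ solve 1 (λ K → con 3 :+ con 2 :* K :+ (con 4 :* (con 1 :+ K) :+ con 1) := con 2 :+ con 6 :* (con 1 :+ K)) refl K ⟩
  2 + 6 * suc K
    ≡⟨ cong (_∸ 4) (*-suc 6 (suc K)) ⟨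
  6 * (2 + K) ∸ 4 ∎
  where
    open ≡-Reasoning
    open +-*-Solver
    top : ℕ
    top = 3 + double K
    rest : count vertical (teeth (suc K) ++ base) ≡ 4 * suc K + 1
    rest = trans (count-++₃ vertical (teeth (suc K)) (south 2 0 1) (west 0 0 2))
                 (cong₂ _+_ (count-vertical-teeth (suc K)) (cong₂ _+_ (count-vertical-south 2 0 1) (count-vertical-west 0 0 2)))

module _ (q : ℕ) where

  private
    notch-tail loop-tail : List Move
    notch-tail = west (3 + q) (1 + q) 1 ++ north (3 + q) (1 + q) 1
    loop-tail = south 1 (1 + q) 1 ++ east 1 (1 + q) (1 + q)

    box-notch-tail : TargetsIn (3 + q) (4 + q) (1 + q) (3 + q) notch-tail
    box-notch-tail = All.++⁺
      (box-weaken ≤-refl ≤-refl ≤-refl (n≤1+n _) (box-west (3 + q) (1 + q) 1))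
      (box-weaken ≤-refl ≤-refl (n≤1+n _) ≤-refl (box-north (3 + q) (1 + q) 1))

    box-notch : TargetsIn (3 + q) (5 + q) (1 + q) (3 + q) (notch q)
    box-notch = All.++⁺
      (box-weaken (n≤1+n _) ≤-refl ≤-refl ≤-refl (box-south (4 + q) (1 + q) 2))
      (box-weaken ≤-refl (n≤1+n _) ≤-refl ≤-refl box-notch-tail)

    box-loop-tail : TargetsIn 1 (3 + q) (1 + q) (2 + q) loop-tail
    box-loop-tail = All.++⁺
      (box-weaken ≤-refl (s≤s (s≤s z≤n)) ≤-refl ≤-refl (box-south 1 (1 + q) 1))
      (box-weaken (n≤1+n _) (≤-reflexive (cong suc (+-comm (1 + q) 1))) ≤-refl ≤-refl (box-east 1 (1 + q) (1 + q)))

    box-loop : TargetsIn 1 (3 + q) (1 + q) (3 + q) (loop q)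
    box-loop = All.++⁺
      (box-weaken ≤-refl (≤-reflexive (+-comm (2 + q) 1)) (n≤1+n _) ≤-refl (box-west 1 (2 + q) (2 + q)))
      (box-weaken ≤-refl ≤-refl ≤-refl (n≤1+n _) box-loop-tail)

  box-tooth : TargetsIn 1 (5 + q) (1 + q) (3 + q) (tooth q)
  box-tooth = All.++⁺
    (box-weaken (s≤s z≤n) ≤-refl ≤-refl ≤-refl box-notch)
    (box-weaken ≤-refl (m≤n+m _ 2) ≤-refl ≤-refl box-loop)

  unique-tooth : Unique (targets (tooth q))
  unique-tooth = Unique-targets-++ (notch q) (loop q)
    (Unique-targets-++ (south (4 + q) (1 + q) 2) notch-tail (unique-south (4 + q) (1 + q) 2)
      (Unique-targets-++ (west (3 + q) (1 + q) 1) (north (3 + q) (1 + q) 1)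
        (unique-west (3 + q) (1 + q) 1) (unique-north (3 + q) (1 + q) 1)
        (apart-disjoint (box-west (3 + q) (1 + q) 1) (box-north (3 + q) (1 + q) 1) (inj₂ (inj₂ (inj₁ ≤-refl)))))
      (apart-disjoint (box-south (4 + q) (1 + q) 2) box-notch-tail (inj₂ (inj₁ ≤-refl))))
    (Unique-targets-++ (west 1 (2 + q) (2 + q)) loop-tail (unique-west 1 (2 + q) (2 + q))
      (Unique-targets-++ (south 1 (1 + q) 1) (east 1 (1 + q) (1 + q))
        (unique-south 1 (1 + q) 1) (unique-east 1 (1 + q) (1 + q))
        (apart-disjoint (box-south 1 (1 + q) 1) (box-east 1 (1 + q) (1 + q)) (inj₁ ≤-refl)))
      (apart-disjoint (box-west 1 (2 + q) (2 + q)) box-loop-tail (inj₂ (inj₂ (inj₂ ≤-refl)))))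
    (apart-disjoint box-notch box-loop (inj₂ (inj₁ ≤-refl)))

box-teeth : (s : ℕ) → TargetsIn 1 (3 + double s) 1 (1 + double s) (teeth s)
box-teeth zero = []
box-teeth (suc s) = All.++⁺
  (box-weaken ≤-refl ≤-refl (s≤s z≤n) ≤-refl (box-tooth (double s)))
  (box-weaken ≤-refl (m≤n+m _ 2) ≤-refl (m≤n+m _ 2) (box-teeth s))

unique-teeth : (s : ℕ) → Unique (targets (teeth s))
unique-teeth zero = []
unique-teeth (suc s) = Unique-targets-++ (tooth (double s)) (teeth s) (unique-tooth (double s)) (unique-teeth s)
  (apart-disjoint (box-tooth (double s)) (box-teeth s) (inj₂ (inj₂ (inj₂ ≤-refl))))

module _ (K : ℕ) where

  private
    top : ℕ
    top = 3 + double K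

    box-north-side : TargetsIn 0 1 1 (suc top) (north 0 0 top)
    box-north-side = box-weaken ≤-refl ≤-refl ≤-refl (≤-reflexive (cong suc (+-identityʳ top))) (box-north 0 0 top)

    box-top-side : TargetsIn 1 (2 + top) top (suc top) (east 0 top (suc top))
    box-top-side = box-weaken ≤-refl (≤-reflexive (cong suc (+-identityʳ (suc top)))) ≤-refl ≤-refl (box-east 0 top (suc top))

    box-base : TargetsIn 0 3 0 1 base
    box-base = All.++⁺ (box-weaken z≤n ≤-refl ≤-refl ≤-refl (box-south 2 0 1))
                       (box-weaken ≤-refl (n≤1+n 2) ≤-refl ≤-refl (box-west 0 0 2))

  box-comb : TargetsIn 0 (2 + top) 0 (suc top) (comb K)
  box-comb = All.++⁺ (box-weaken ≤-refl (s≤s z≤n) z≤n ≤-refl box-north-side)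
    (All.++⁺ (box-weaken z≤n ≤-refl z≤n ≤-refl box-top-side)
      (All.++⁺ (box-weaken z≤n ≤-refl z≤n (n≤1+n _) (box-teeth (suc K)))
               (box-weaken ≤-refl (s≤s (s≤s (s≤s z≤n))) ≤-refl (s≤s z≤n) box-base)))

  unique-comb : Unique (targets (comb K))
  unique-comb =
    Unique-targets-++ (north 0 0 top) rest₁ (unique-north 0 0 top)
      (Unique-targets-++ (east 0 top (suc top)) rest₂ (unique-east 0 top (suc top))
        (Unique-targets-++ (teeth (suc K)) base (unique-teeth (suc K))
          (Unique-targets-++ (south 2 0 1) (west 0 0 2) (unique-south 2 0 1) (unique-west 0 0 2)
            (apart-disjoint (box-south 2 0 1) (box-west 0 0 2) (inj₂ (inj₁ ≤-refl))))
          (apart-disjoint (box-teeth (suc K)) box-base (inj₂ (inj₂ (inj₂ ≤-refl)))))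
        (Disjoint-targets-++ (teeth (suc K)) base {east 0 top (suc top)}
          (apart-disjoint box-top-side (box-teeth (suc K)) (inj₂ (inj₂ (inj₂ ≤-refl))))
          (apart-disjoint box-top-side box-base (inj₂ (inj₂ (inj₂ (s≤s z≤n)))))))
      (Disjoint-targets-++ (east 0 top (suc top)) rest₂ {north 0 0 top}
        (apart-disjoint box-north-side box-top-side (inj₁ ≤-refl))
        (Disjoint-targets-++ (teeth (suc K)) base {north 0 0 top}
          (apart-disjoint box-north-side (box-teeth (suc K)) (inj₁ ≤-refl))
          (apart-disjoint box-north-side box-base (inj₂ (inj₂ (inj₂ ≤-refl))))))
    where
      rest₁ rest₂ : List Move
      rest₂ = teeth (suc K) ++ base
      rest₁ = east 0 top (suc top) ++ rest₂

  4≤length-comb : 4 ≤ length (comb K)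
  4≤length-comb =
    s≤s (s≤s (s≤s (≤-trans (s≤s z≤n) (≤-trans (m≤n+m _ _) (≤-reflexive (sym (length-++ (north 0 3 (double K)))))))))

module Comb (K : ℕ) = ClosedWalk (comb K) (walk-comb K) (adjacent-comb K) (unique-comb K) (4≤length-comb K)

halve : (K j : ℕ) → j ≤ suc (double K) → ∃ λ s → s ≤ K × (j ≡ double s ⊎ j ≡ suc (double s))
halve K zero _ = 0 , z≤n , inj₁ refl
halve K (suc zero) _ = 0 , z≤n , inj₂ refl
halve zero (suc (suc j)) (s≤s ())
halve (suc K) (suc (suc j)) (s≤s (s≤s j≤)) with halve K j j≤
... | s , s≤K , inj₁ refl = suc s , s≤s s≤K , inj₁ refl
... | s , s≤K , inj₂ refl = suc s , s≤s s≤K , inj₂ refl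

∈-teeth : {m : Move} (n s : ℕ) → s < n → m ∈ tooth (double s) → m ∈ teeth n
∈-teeth (suc n) s (s≤s s≤n) m∈ with m≤n⇒m<n∨m≡n s≤n
... | inj₁ s<n = ∈-++⁺ʳ (tooth (double n)) (∈-teeth n s s<n m∈)
... | inj₂ refl = ∈-++⁺ˡ m∈

module _ {K : ℕ} {m : Move} where

  ∈-comb-left : m ∈ north 0 0 (3 + double K) → m ∈ comb K
  ∈-comb-left = ∈-++⁺ˡ

  ∈-comb-top : m ∈ east 0 (3 + double K) (4 + double K) → m ∈ comb K
  ∈-comb-top m∈ = ∈-++⁺ʳ (north 0 0 (3 + double K)) (∈-++⁺ˡ m∈)

  ∈-comb-tooth : (s : ℕ) → s ≤ K → m ∈ tooth (double s) → m ∈ comb K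
  ∈-comb-tooth s s≤K m∈ =
    ∈-++⁺ʳ (north 0 0 (3 + double K)) (∈-++⁺ʳ (east 0 (3 + double K) (4 + double K))
      (∈-++⁺ˡ (∈-teeth (suc K) s (s≤s s≤K) m∈)))

  ∈-comb-base : m ∈ base → m ∈ comb K
  ∈-comb-base m∈ =
    ∈-++⁺ʳ (north 0 0 (3 + double K)) (∈-++⁺ʳ (east 0 (3 + double K) (4 + double K)) (∈-++⁺ʳ (teeth (suc K)) m∈))

column-one-bonds : (K i : ℕ) → i ≤ 3 + double K → (+ 1 , + i) ∈ hbonds (Comb.polygon K)
column-one-bonds K zero _ = Comb.∈-hbonds K (∈-comb-base (∈-++⁺ʳ (south 2 0 1) (here refl))) refl
column-one-bonds K (suc i) i≤top with suc i ≟ 3 + double K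
... | yes refl = Comb.∈-hbonds K (∈-comb-top (there (here refl))) refl
... | no i≢top with halve K i (≤-pred (≤-pred (≤∧≢⇒< i≤top i≢top)))
...   | s , s≤K , inj₁ refl = Comb.∈-hbonds K (∈-comb-tooth s s≤K (∈-++⁺ʳ (notch (double s))
  (∈-++⁺ʳ (west 1 (2 + double s) (2 + double s)) (∈-++⁺ʳ (south 1 (1 + double s) 1) (here refl))))) refl
...   | s , s≤K , inj₂ refl = Comb.∈-hbonds K (∈-comb-tooth s s≤K (∈-++⁺ʳ (notch (double s))
  (∈-++⁺ˡ (last∈west 1 (2 + double s) (suc (double s)))))) refl

left-wall : (K j : ℕ) → j < 3 + double K → (+ 0 , + j) ∈ vbonds (Comb.polygon K)
left-wall K j j<top =
  subst (λ t → (+ 0 , + t) ∈ vbonds (Comb.polygon K)) (trans (m≤n⇒m⊓n≡m (n≤1+n _)) (+-identityʳ j))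
    (Comb.∈-vbonds K (∈-comb-left (∈-north 0 0 (3 + double K) j j<top)) refl)

right-wall : (K j : ℕ) → j < 3 + double K → ∃ λ a → 2 ≤ a × (+ a , + j) ∈ vbonds (Comb.polygon K)
right-wall K zero _ = 2 , ≤-refl , Comb.∈-vbonds K (∈-comb-base (here refl)) refl
right-wall K (suc j) j<top with halve K j (≤-pred (≤-pred j<top))
... | s , s≤K , inj₁ refl = 4 + double s , s≤s (s≤s z≤n) ,
  subst (λ t → (+ (4 + double s) , + t) ∈ vbonds (Comb.polygon K)) (m≥n⇒m⊓n≡n (n≤1+n _))
    (Comb.∈-vbonds K (∈-comb-tooth s s≤K (there (here refl))) (eqℤ-refl (+ (4 + double s))))
... | s , s≤K , inj₂ refl = 4 + double s , s≤s (s≤s z≤n) ,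
  subst (λ t → (+ (4 + double s) , + t) ∈ vbonds (Comb.polygon K)) (m≥n⇒m⊓n≡n (n≤1+n _))
    (Comb.∈-vbonds K (∈-comb-tooth s s≤K (here refl)) (eqℤ-refl (+ (4 + double s))))

comb-uncut : (K j : ℕ) → j < 3 + double K → T (uncut (Comb.polygon K) (+ 1) (+ j))
comb-uncut K j j<top with right-wall K j j<top
... | a , 2≤a , a∈ = T-∧⁺ {blockedLeftBy (Comb.polygon K) (+ 1) (+ j)}
  (any⁺ (λ v → eqℤ (proj₂ v) (+ j) ∧ (proj₁ v ≤ᵇ + 1)) (lose (left-wall K j j<top) (T-∧⁺ (T-eqℤ-refl (+ j)) tt)))
  (any⁺ (λ v → eqℤ (proj₂ v) (+ j) ∧ ((+ 1 ℤ.+ 1ℤ) ≤ᵇ proj₁ v))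
        (lose a∈ (T-∧⁺ (T-eqℤ-refl (+ j)) (ℤ.≤⇒≤ᵇ (+≤+ 2≤a)))))

Avoids-below : {c : ℤ} {n : ℕ} (lo hi : ℕ) → (c ≡ + n) → hi ≤ n → Avoids c lo hi
Avoids-below lo hi refl hi≤n m _ m<hi eq = <-irrefl (sym (ℤ.+-injective eq)) (<-≤-trans m<hi hi≤n)

Avoids-above : {c : ℤ} {n : ℕ} (lo hi : ℕ) → (c ≡ + n) → n < lo → Avoids c lo hi
Avoids-above lo hi refl n<lo m lo≤m _ eq = <-irrefl (ℤ.+-injective eq) (<-≤-trans n<lo lo≤m)

Avoids-single : {c : ℤ} (n : ℕ) → c ≢ + n → Avoids c n (1 + n)
Avoids-single n c≢n m n≤m m<1+n eq = c≢n (trans eq (cong +_ (≤-antisym (≤-pred m<1+n) n≤m)))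

count-horizontalAt-tooth : (c : ℤ) (q : ℕ) → count (horizontalAt c) (tooth q) ≡
  count (horizontalAt c) (west (3 + q) (1 + q) 1) +
  (count (horizontalAt c) (west 1 (2 + q) (2 + q)) + count (horizontalAt c) (east 1 (1 + q) (1 + q)))
count-horizontalAt-tooth c q = begin
  count h (notch q ++ loop q)
    ≡⟨ count-++ h (notch q) (loop q) ⟩
  count h (notch q) + count h (loop q)
    ≡⟨ cong₂ _+_ (count-++₃ h (south (4 + q) (1 + q) 2) (west (3 + q) (1 + q) 1) (north (3 + q) (1 + q) 1))
                 (count-++₃ h (west 1 (2 + q) (2 + q)) (south 1 (1 + q) 1) (east 1 (1 + q) (1 + q))) ⟩
  count h (south (4 + q) (1 + q) 2) + (count h (west (3 + q) (1 + q) 1) + count h (north (3 + q) (1 + q) 1)) +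
  (count h (west 1 (2 + q) (2 + q)) + (count h (south 1 (1 + q) 1) + count h (east 1 (1 + q) (1 + q))))
    ≡⟨ cong₂ _+_ (cong₂ _+_ (count-horizontalAt-south c (4 + q) (1 + q) 2)
                            (cong (_+_ (count h (west (3 + q) (1 + q) 1))) (count-horizontalAt-north c (3 + q) (1 + q) 1)))
                 (cong (_+_ (count h (west 1 (2 + q) (2 + q)))) (cong (_+ count h (east 1 (1 + q) (1 + q)))
                   (count-horizontalAt-south c 1 (1 + q) 1))) ⟩
  count h (west (3 + q) (1 + q) 1) + 0 + (count h (west 1 (2 + q) (2 + q)) + count h (east 1 (1 + q) (1 + q)))
    ≡⟨ cong (_+ (count h (west 1 (2 + q) (2 + q)) + count h (east 1 (1 + q) (1 + q))))
            (+-identityʳ (count h (west (3 + q) (1 + q) 1))) ⟩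
  count h (west (3 + q) (1 + q) 1) + (count h (west 1 (2 + q) (2 + q)) + count h (east 1 (1 + q) (1 + q))) ∎
  where
    open ≡-Reasoning
    h : Move → Bool
    h = horizontalAt c

count-horizontalAt-tooth≤2 : (c : ℤ) (q : ℕ) → count (horizontalAt c) (tooth q) ≤ 2
count-horizontalAt-tooth≤2 c q rewrite count-horizontalAt-tooth c q with c ℤ.≟ + (3 + q)
... | yes c≡3+q rewrite count-horizontalAt-west-outside c 1 (2 + q) (2 + q) (Avoids-below 1 _ c≡3+q (≤-reflexive (+-comm (2 + q) 1)))
                      | count-horizontalAt-east-outside c 1 (1 + q) (1 + q)
                          (Avoids-below 1 _ c≡3+q (≤-trans (≤-reflexive (+-comm (1 + q) 1)) (n≤1+n _)))
                      | +-identityʳ (count (horizontalAt c) (west (3 + q) (1 + q) 1)) =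
  ≤-trans (count-horizontalAt-west≤1 c (3 + q) (1 + q) 1) (n≤1+n 1)
... | no c≢3+q rewrite count-horizontalAt-west-outside c (3 + q) (1 + q) 1 (Avoids-single (3 + q) c≢3+q) =
  +-mono-≤ (count-horizontalAt-west≤1 c 1 (2 + q) (2 + q)) (count-horizontalAt-east≤1 c 1 (1 + q) (1 + q))

count-horizontalAt-tooth-column0 : (q : ℕ) → count (horizontalAt (+ 0)) (tooth q) ≡ 0
count-horizontalAt-tooth-column0 q
  rewrite count-horizontalAt-tooth (+ 0) q
        | count-horizontalAt-west-outside (+ 0) (3 + q) (1 + q) 1 (Avoids-above _ _ refl (s≤s z≤n))
        | count-horizontalAt-west-outside (+ 0) 1 (2 + q) (2 + q) (Avoids-above _ _ refl (s≤s z≤n))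
        | count-horizontalAt-east-outside (+ 0) 1 (1 + q) (1 + q) (Avoids-above _ _ refl (s≤s z≤n)) = refl

count-horizontalAt-teeth : (c : ℤ) (s : ℕ) → count (horizontalAt c) (teeth s) ≤ 2 * s
count-horizontalAt-teeth c zero = z≤n
count-horizontalAt-teeth c (suc s) rewrite count-++ (horizontalAt c) (tooth (double s)) (teeth s) | *-suc 2 s =
  +-mono-≤ (count-horizontalAt-tooth≤2 c (double s)) (count-horizontalAt-teeth c s)

count-horizontalAt-teeth-column0 : (s : ℕ) → count (horizontalAt (+ 0)) (teeth s) ≡ 0
count-horizontalAt-teeth-column0 zero = refl
count-horizontalAt-teeth-column0 (suc s)
  rewrite count-++ (horizontalAt (+ 0)) (tooth (double s)) (teeth s) | count-horizontalAt-tooth-column0 (double s) =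
    count-horizontalAt-teeth-column0 s

count-horizontalAt-base : (c : ℤ) → count (horizontalAt c) base ≤ 1
count-horizontalAt-base c rewrite count-++ (horizontalAt c) (south 2 0 1) (west 0 0 2) | count-horizontalAt-south c 2 0 1 =
  count-horizontalAt-west≤1 c 0 0 2

count-horizontalAt-base-outside : (c : ℤ) → c ≢ + 0 → c ≢ + 1 → count (horizontalAt c) base ≡ 0
count-horizontalAt-base-outside c c≢0 c≢1
  rewrite count-++ (horizontalAt c) (south 2 0 1) (west 0 0 2) | count-horizontalAt-south c 2 0 1 =
    count-horizontalAt-west-outside c 0 0 2 avoids
  where
    avoids : Avoids c 0 2
    avoids zero _ _ = c≢0
    avoids (suc zero) _ _ = c≢1
    avoids (suc (suc m)) _ (s≤s (s≤s ()))

count-horizontalAt-teeth+base : (K : ℕ) (c : ℤ) → c ≢ + 1 →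
  count (horizontalAt c) (teeth (suc K)) + count (horizontalAt c) base ≤ 2 * suc K
count-horizontalAt-teeth+base K c c≢1 with c ℤ.≟ + 0
... | yes refl rewrite count-horizontalAt-teeth-column0 (suc K) =
  ≤-trans (count-horizontalAt-base (+ 0)) (s≤s z≤n)
... | no c≢0 rewrite count-horizontalAt-base-outside c c≢0 c≢1 =
  ≤-trans (≤-reflexive (+-identityʳ _)) (count-horizontalAt-teeth c (suc K))

comb-column-count : (K : ℕ) (c : ℤ) → c ≢ + 1 → count (horizontalAt c) (comb K) < 2 * (2 + K)
comb-column-count K c c≢1 = begin-strict
  count h (comb K)
    ≡⟨ count-++₃ h (north 0 0 top) (east 0 top (suc top)) (teeth (suc K) ++ base) ⟩
  count h (north 0 0 top) + (count h (east 0 top (suc top)) + count h (teeth (suc K) ++ base))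
    ≡⟨ cong₂ _+_ (count-horizontalAt-north c 0 0 top)
                 (cong (_+_ (count h (east 0 top (suc top)))) (count-++ h (teeth (suc K)) base)) ⟩
  count h (east 0 top (suc top)) + (count h (teeth (suc K)) + count h base)
    ≤⟨ +-mono-≤ (count-horizontalAt-east≤1 c 0 top (suc top)) (count-horizontalAt-teeth+base K c c≢1) ⟩
  1 + 2 * suc K
    <⟨ n<1+n _ ⟩
  2 + 2 * suc K
    ≡⟨ *-suc 2 (suc K) ⟨
  2 * (2 + K) ∎
  where
    open ≤-Reasoning
    h : Move → Bool
    h = horizontalAt c
    top : ℕ
    top = 3 + double K

comb-heights : (K : ℕ) {h : Point} → h ∈ hbonds (Comb.polygon K) → ∃ λ b → proj₂ h ≡ + b × b ≤ 3 + double K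
comb-heights K h∈ with Comb.hbonds⁻ K h∈
... | ((a , b) , _) , e∈ , refl = b , refl ,
  ≤-pred (proj₂ (proj₂ (proj₂ (All.lookup (All.map⁺ (box-comb K))
    (sources⊆targets (comb K) (walk-comb K) (∈-map⁺ proj₁ e∈))))))

comb-page : (K i : ℕ) → i ≤ 3 + double K → SamePage (Comb.polygon K) (+ 1) (+ 0) (+ i)
comb-page K i i≤top (+ j) _ (+<+ j<i) = comb-uncut K j (<-≤-trans j<i i≤top)

comb-exactly-one : (K : ℕ) → ExactlyOneKSection (Comb.polygon K) (2 + K)
comb-exactly-one K = + 1 , + 0 , section , only
  where
    P : SAP
    P = Comb.polygon K
    top : ℕ
    top = 3 + double K
    2k≡1+top : 2 * (2 + K) ≡ suc top
    2k≡1+top = trans (*-suc 2 (suc K)) (cong (_+_ 2) (trans (*-suc 2 K) (cong (_+_ 2) (sym (double≡2* K)))))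
    heights : List ℤ
    heights = map +_ (upTo (2 * (2 + K)))
    in-column : ∀ y → y ∈ heights → (+ 1 , y) ∈ hbonds P × SamePage P (+ 1) (+ 0) y
    in-column y y∈ with ∈-map⁻ +_ y∈
    ... | i , i∈ , refl = column-one-bonds K i i≤top , comb-page K i i≤top
      where
        i≤top : i ≤ top
        i≤top = ≤-pred (subst (i <_) 2k≡1+top (∈-upTo⁻ i∈))
    from-column : ∀ y → (+ 1 , y) ∈ hbonds P × SamePage P (+ 1) (+ 0) y → y ∈ heights
    from-column y (b∈ , _) with comb-heights K b∈
    ... | b , refl , b≤top = ∈-map⁺ +_ (∈-upTo⁺ (subst (b <_) (sym 2k≡1+top) (s≤s b≤top)))
    section : KSection P (2 + K) (+ 1) (+ 0)
    section = column-one-bonds K 0 z≤n , heights ,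
      Unique.map⁺ ℤ.+-injective (Unique.upTo⁺ (2 * (2 + K))) ,
      trans (length-map +_ (upTo (2 * (2 + K)))) (length-upTo (2 * (2 + K))) ,
      λ y → mk⇔ (in-column y) (from-column y)
    only : ∀ x′ y′ → KSection P (2 + K) x′ y′ → x′ ≡ + 1 × SamePage P (+ 1) (+ 0) y′
    only x′ y′ section′ with x′ ℤ.≟ + 1
    ... | no x′≢1 = ⊥-elim (<⇒≱ (comb-column-count K x′ x′≢1) (begin
      2 * (2 + K)
        ≤⟨ span-column-bound (KSection⇒Span {P} {2 + K} {x′} {y′} section′) ⟩
      length (filterᵇ (λ h → eqℤ (proj₁ h) x′) (hbonds P))
        ≡⟨ length-filterᵇ _ (hbonds P) ⟩
      count (λ h → eqℤ (proj₁ h) x′) (hbonds P)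
        ≡⟨ Comb.count-column K x′ ⟩
      count (horizontalAt x′) (comb K) ∎))
      where open ≤-Reasoning
    ... | yes refl with comb-heights K (proj₁ section′)
    ...   | b , refl , b≤top = refl , comb-page K b b≤top

square : SAP
square = record
  { verts = (+ 0 , + 0) ∷ (+ 1 , + 0) ∷ (+ 1 , + 1) ∷ (+ 0 , + 1) ∷ []
  ; long = s≤s (s≤s (s≤s (s≤s z≤n)))
  ; distinct = ((λ ()) ∷ (λ ()) ∷ (λ ()) ∷ []) ∷ ((λ ()) ∷ (λ ()) ∷ []) ∷ ((λ ()) ∷ []) ∷ [] ∷ []
  ; closed = inj₁ (refl , refl) ∷ inj₂ (inj₂ (inj₁ (refl , refl))) ∷ inj₂ (inj₁ (refl , refl))
           ∷ inj₂ (inj₂ (inj₂ (refl , refl))) ∷ []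
  }

square-bonds : ∀ {x y} → (x , y) ∈ hbonds square → x ≡ + 0 × (y ≡ + 0 ⊎ y ≡ + 1)
square-bonds (here refl) = refl , inj₁ refl
square-bonds (there (here refl)) = refl , inj₂ refl

square-page : ∀ {y} → y ≡ + 0 ⊎ y ≡ + 1 → SamePage square (+ 0) (+ 0) y
square-page (inj₁ refl) j 0≤j j<0 = ⊥-elim (ℤ.<-irrefl refl (ℤ.≤-<-trans 0≤j j<0))
square-page (inj₂ refl) (+ zero) _ _ = tt
square-page (inj₂ refl) (+ suc j) _ (+<+ (s≤s ()))

square-exactly-one : ExactlyOneKSection square 1
square-exactly-one = + 0 , + 0 , section , only
  where
    section : KSection square 1 (+ 0) (+ 0)
    section = here refl , (+ 0 ∷ + 1 ∷ []) , ((λ ()) ∷ []) ∷ [] ∷ [] , refl , λ y → mk⇔ (to y) (from y)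
      where
        to : ∀ y → y ∈ + 0 ∷ + 1 ∷ [] → (+ 0 , y) ∈ hbonds square × SamePage square (+ 0) (+ 0) y
        to y (here refl) = here refl , square-page (inj₁ refl)
        to y (there (here refl)) = there (here refl) , square-page (inj₂ refl)
        from : ∀ y → (+ 0 , y) ∈ hbonds square × SamePage square (+ 0) (+ 0) y → y ∈ + 0 ∷ + 1 ∷ []
        from y (b∈ , _) with square-bonds b∈
        ... | _ , inj₁ refl = here refl
        ... | _ , inj₂ refl = there (here refl)
    only : ∀ x′ y′ → KSection square 1 x′ y′ → x′ ≡ + 0 × SamePage square (+ 0) (+ 0) y′
    only x′ y′ (b∈ , _) = proj₁ (square-bonds b∈) , square-page (proj₂ (square-bonds b∈))

extremal-polygon : (k : ℕ) → 1 ≤ k → Σ SAP (λ P → length (vbonds P) ≡ 6 * k ∸ 4 × ExactlyOneKSection P k)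
extremal-polygon 1 _ = square , refl , square-exactly-one
extremal-polygon (suc (suc K)) _ =
  Comb.polygon K , trans (Comb.length-vbonds K) (count-vertical-comb K) , comb-exactly-one K

lemma5 : (k : ℕ) → 1 ≤ k →
    ((P : SAP) (x y0 : ℤ) → KSection P k x y0 →
       (3 * k ∸ 2 ≤ length (leftV P x) ×
        2 * k ∸ 1 ≤ length (filterᵇ (obstructs P) (leftV P x))) ×
       (3 * k ∸ 2 ≤ length (rightV P x) ×
        2 * k ∸ 1 ≤ length (filterᵇ (obstructs P) (rightV P x)))) ×
    ((P : SAP) → length (vbonds P) < 6 * k ∸ 4 →
       (x y0 : ℤ) → ¬ KSection P k x y0) ×
    Σ SAP (λ P → length (vbonds P) ≡ 6 * k ∸ 4 × ExactlyOneKSection P k)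
lemma5 k 1≤k = section-bounds k , no-small-section k , extremal-polygon k 1≤k
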